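{- There is no Turing functional $\Psi$ such that, for every atomic diagram $F$ (in the signature $\{+,\cdot\}$) of a countable field with domain $\omega$, $\Psi^F$ computes the atomic diagram, in the signature $\{+,\cdot,T\}$, of a structure whose $\{+,\cdot\}$-reduct is a field isomorphic to $F$ and in which $T$ is interpreted as the unary transcendence relation of that field. The same holds with the finitary algebraic independence relation $I$ in place of $T$.
   Context: For a field $L$ with prime subfield $Q$, the transcendence relation is $T=\{x\in L : f(x)\neq 0 \text{ for all nonzero } f\in Q[X]\}$, and the algebraic independence relation $I$ is the set of all finite tuples $(x_1,\ldots,x_n)$ (of any length $n$) from $L$ such that $f(x_1,\ldots,x_n)\neq 0$ for all nonzero $f\in Q[X_1,\ldots,X_n]$. -}

module Defs where

open import Data.Nat using (ℕ; zero; suc) renaming (_+_ to _+ℕ_; _*_ to _*ℕ_; _^_ to _^ℕ_)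
open import Data.Bool using (Bool; true; false)
open import Data.Fin using (Fin)
open import Data.Vec using (Vec; []; _∷_; lookup)
open import Data.List using (List; []; _∷_; length)
open import Data.List.Relation.Unary.All using (All)
open import Data.List.Relation.Unary.Any using (Any)
open import Data.Product using (Σ; ∃; ∃-syntax; _×_; _,_)
open import Data.Empty using (⊥)
open import Relation.Nullary using (¬_)
open import Relation.Binary.PropositionalEquality using (_≡_; _≢_)
open import Algebra.Structures using (IsCommutativeRing)
open import Function.Bundles using (_⇔_)
open import Function.Definitions using (Bijective)

-- Oracle computation: partial recursive functions relative to an oracle
-- O : ℕ → Bool.  A Turing functional Ψ is a (unary) program of this
-- language; Ψ^O is its semantics with oracle O.

data Prog : ℕ → Set where
  zeroP  : ∀ {n} → Prog n
  succP  : Prog 1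
  projP  : ∀ {n} → Fin n → Prog n
  compP  : ∀ {m n} → Prog m → (Fin m → Prog n) → Prog n
  precP  : ∀ {n} → Prog n → Prog (suc (suc n)) → Prog (suc n)
  muP    : ∀ {n} → Prog (suc n) → Prog n
  oracleP : Prog 1

bit : Bool → ℕ
bit true  = 1
bit false = 0

data Eval (O : ℕ → Bool) : ∀ {n} → Prog n → Vec ℕ n → ℕ → Set where
  evZero   : ∀ {n} {xs : Vec ℕ n} → Eval O zeroP xs 0
  evSucc   : ∀ {x} → Eval O succP (x ∷ []) (suc x)
  evProj   : ∀ {n} {i : Fin n} {xs} → Eval O (projP i) xs (lookup xs i)
  evComp   : ∀ {m n} {f : Prog m} {gs : Fin m → Prog n} {xs} {ys : Vec ℕ m} {v} →
             (∀ i → Eval O (gs i) xs (lookup ys i)) → Eval O f ys v →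
             Eval O (compP f gs) xs v
  evPrec0  : ∀ {n} {f : Prog n} {g} {xs} {v} →
             Eval O f xs v → Eval O (precP f g) (0 ∷ xs) v
  evPrecS  : ∀ {n} {f : Prog n} {g} {k xs} {u v} →
             Eval O (precP f g) (k ∷ xs) u → Eval O g (k ∷ u ∷ xs) v →
             Eval O (precP f g) (suc k ∷ xs) v
  evMu     : ∀ {n} {f : Prog (suc n)} {xs} {y} →
             Eval O f (y ∷ xs) 0 →
             (∀ z → z Data.Nat.< y → Σ ℕ λ w → Eval O f (z ∷ xs) (suc w)) →
             Eval O (muP f) xs y
  evOracle : ∀ {x} → Eval O oracleP (x ∷ []) (bit (O x))

Computes : Prog 1 → (ℕ → Bool) → (ℕ → Bool) → Set
Computes Ψ O D = ∀ x → Eval O Ψ (x ∷ []) (bit (D x))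

pair : ℕ → ℕ → ℕ
pair a b = (2 ^ℕ a) *ℕ suc (2 *ℕ b)

codeList : List ℕ → ℕ
codeList []       = 0
codeList (x ∷ xs) = pair x (codeList xs)

record FieldOnℕ : Set where
  field
    _+_ _*_   : ℕ → ℕ → ℕ
    0# 1#     : ℕ
    -_        : ℕ → ℕ
    isCommutativeRing : IsCommutativeRing _≡_ _+_ _*_ -_ 0# 1#
    0≢1       : 0# ≢ 1#
    inverse   : ∀ x → x ≢ 0# → ∃[ y ] (x * y ≡ 1#)

  ι : ℕ → ℕ
  ι zero    = 0#
  ι (suc n) = 1# + ι n

  InPrime : ℕ → Set
  InPrime x = ∃[ a ] ∃[ b ] ∃[ c ] (ι c ≢ 0# × x * ι c ≡ ι a + (- ι b))

  -- polynomials in n variables, Q[X_1,...,X_n] = Q[X_1,...,X_{n-1}][X_n]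
  -- (coefficient lists, lowest degree first)
  Poly : ℕ → Set
  Poly zero    = ℕ
  Poly (suc n) = List (Poly n)

  CoeffsInPrime : ∀ n → Poly n → Set
  CoeffsInPrime zero    c  = InPrime c
  CoeffsInPrime (suc n) cs = All (CoeffsInPrime n) cs

  NonZeroPoly : ∀ n → Poly n → Set
  NonZeroPoly zero    c  = c ≢ 0#
  NonZeroPoly (suc n) cs = Any (NonZeroPoly n) cs

  evalPoly : ∀ n → Poly n → Vec ℕ n → ℕ
  evalPoly zero    c  []       = c
  evalPoly (suc n) [] (x ∷ xs) = 0#
  evalPoly (suc n) (c ∷ cs) (x ∷ xs) =
    evalPoly n c xs + (x * evalPoly (suc n) cs (x ∷ xs))

  Transc : ℕ → Set
  Transc x = ∀ (f : Poly 1) → CoeffsInPrime 1 f → NonZeroPoly 1 f →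
             evalPoly 1 f (x ∷ []) ≢ 0#

  AlgIndep : List ℕ → Set
  AlgIndep xs = ∀ (f : Poly (length xs)) → CoeffsInPrime (length xs) f →
                NonZeroPoly (length xs) f →
                evalPoly (length xs) f (Data.Vec.fromList xs) ≢ 0#

open FieldOnℕ

_≅_ : FieldOnℕ → FieldOnℕ → Set
K ≅ L = Σ (ℕ → ℕ) λ h → Bijective _≡_ _≡_ h ×
        (∀ x y → h (_+_ K x y) ≡ _+_ L (h x) (h y)) ×
        (∀ x y → h (_*_ K x y) ≡ _*_ L (h x) (h y))

data Term : Set where
  con   : ℕ → Term
  plus  : Term → Term → Term
  times : Term → Term → Term

codeTerm : Term → ℕ
codeTerm (con n)     = pair 0 n
codeTerm (plus s t)  = pair 1 (pair (codeTerm s) (codeTerm t))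
codeTerm (times s t) = pair 2 (pair (codeTerm s) (codeTerm t))

codeTerms : List Term → ℕ
codeTerms []       = 0
codeTerms (t ∷ ts) = pair (codeTerm t) (codeTerms ts)

evalTerm : FieldOnℕ → Term → ℕ
evalTerm K (con n)     = n
evalTerm K (plus s t)  = _+_ K (evalTerm K s) (evalTerm K t)
evalTerm K (times s t) = _*_ K (evalTerm K s) (evalTerm K t)

evalTerms : FieldOnℕ → List Term → List ℕ
evalTerms K []       = []
evalTerms K (t ∷ ts) = evalTerm K t ∷ evalTerms K ts

data Atom : Set where
  eqA : Term → Term → Atom

data AtomT : Set where
  eqT : Term → Term → AtomT
  TT  : Term → AtomT

data AtomI : Set where
  eqI : Term → Term → AtomI
  II  : List Term → AtomI

codeAtom : Atom → ℕ
codeAtom (eqA s t) = pair 0 (pair (codeTerm s) (codeTerm t))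

codeAtomT : AtomT → ℕ
codeAtomT (eqT s t) = pair 0 (pair (codeTerm s) (codeTerm t))
codeAtomT (TT t)    = pair 1 (codeTerm t)

codeAtomI : AtomI → ℕ
codeAtomI (eqI s t) = pair 0 (pair (codeTerm s) (codeTerm t))
codeAtomI (II ts)   = pair 1 (codeTerms ts)

Sat : FieldOnℕ → Atom → Set
Sat K (eqA s t) = evalTerm K s ≡ evalTerm K t

SatT : FieldOnℕ → AtomT → Set
SatT K (eqT s t) = evalTerm K s ≡ evalTerm K t
SatT K (TT t)    = Transc K (evalTerm K t)

SatI : FieldOnℕ → AtomI → Set
SatI K (eqI s t) = evalTerm K s ≡ evalTerm K t
SatI K (II ts)   = AlgIndep K (evalTerms K ts)

IsDiagramOf : {A : Set} → (A → ℕ) → (A → Set) → (ℕ → Bool) → Set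
IsDiagramOf {A} code sat D =
  (∀ φ → (D (code φ) ≡ true) ⇔ sat φ) ×
  (∀ x → D x ≡ true → ∃[ φ ] (code φ ≡ x))

IsFieldDiagram : (ℕ → Bool) → Set
IsFieldDiagram F = ∃[ K ] IsDiagramOf codeAtom (Sat K) F

IsTDiagramFor : FieldOnℕ → (ℕ → Bool) → Set
IsTDiagramFor K D = ∃[ L ] (L ≅ K × IsDiagramOf codeAtomT (SatT L) D)

IsIDiagramFor : FieldOnℕ → (ℕ → Bool) → Set
IsIDiagramFor K D = ∃[ L ] (L ≅ K × IsDiagramOf codeAtomI (SatI L) D)

-- Suppose Ψ worked uniformly. On the diagram of ℚ(X), presented on ℕ, it outputs the diagram of a
-- copy of ℚ(X) with its transcendence relation, so it asserts T(n) for the copy n of X. This halting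
-- computation reads only a finite part of the input. That part also lies in the diagram of a suitable
-- presentation of ℚ: specialising X to a large integer N is injective on the finitely many elements
-- involved and respects + and · among them. On that presentation Ψ still asserts T(n), yet ℚ has no
-- transcendental elements. For I the same argument applies, since I(n) for a one-tuple is T(n).

module Submission where

open import Defs
open import Data.Nat using (ℕ)
open import Data.Bool using (Bool)
open import Data.Product using (_×_; _,_; ∃-syntax)
open import Relation.Nullary using (¬_)
open import Function using (id)
open import Function.Bundles using (mk⇔)
open import Data.List using ([]; _∷_)

module Coding where

  open import Data.Nat using (ℕ; zero; suc; _+_; _∸_; _≤_; z≤n; s≤s)
  open import Data.Nat.Properties
  open import Data.Integer using (ℤ; +_; -[1+_])
  open import Data.List using (List; []; _∷_)
  open import Data.Product using (_×_; _,_)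
  open import Relation.Binary.PropositionalEquality using (_≡_; refl; cong)

  triangle : ℕ → ℕ
  triangle zero    = 0
  triangle (suc n) = suc n + triangle n

  cantor : ℕ → ℕ → ℕ
  cantor a b = triangle (a + b) + a

  uncantor : ℕ → ℕ × ℕ
  uncantor zero    = 0 , 0
  uncantor (suc n) with uncantor n
  ... | a , zero  = 0 , suc a
  ... | a , suc b = suc a , b

  private
    uncantor-diagonal : ∀ s a → a ≤ s → uncantor (triangle s + a) ≡ (a , s ∸ a)
    uncantor-diagonal zero    zero    z≤n = refl
    uncantor-diagonal (suc s) zero    z≤n
      rewrite +-identityʳ (s + triangle s) | +-comm s (triangle s)
            | uncantor-diagonal s s ≤-refl | n∸n≡0 s = refl
    uncantor-diagonal s (suc a) a<s
      rewrite +-suc (triangle s) a | uncantor-diagonal s a (<⇒≤ a<s)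
            | +-∸-assoc 1 a<s = refl

  uncantor-cantor : ∀ a b → uncantor (cantor a b) ≡ (a , b)
  uncantor-cantor a b
    rewrite uncantor-diagonal (a + b) a (m≤m+n a b) | m+n∸m≡n a b = refl

  n≤triangle : ∀ n → n ≤ triangle n
  n≤triangle zero    = z≤n
  n≤triangle (suc n) = m≤m+n (suc n) (triangle n)

  n≤cantor : ∀ a b → b ≤ cantor a b
  n≤cantor a b = ≤-trans (m≤n+m b a) (≤-trans (n≤triangle (a + b)) (m≤m+n _ a))

  encodeℤ : ℤ → ℕ
  encodeℤ (+ n)    = cantor 0 n
  encodeℤ -[1+ n ] = cantor 1 n

  decodeℤ : ℕ → ℤ
  decodeℤ k with uncantor k
  ... | zero  , n = + n
  ... | suc _ , n = -[1+ n ]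

  decodeℤ-encodeℤ : ∀ z → decodeℤ (encodeℤ z) ≡ z
  decodeℤ-encodeℤ (+ n)    rewrite uncantor-cantor 0 n = refl
  decodeℤ-encodeℤ -[1+ n ] rewrite uncantor-cantor 1 n = refl

  encodeList : List ℤ → ℕ
  encodeList []       = 0
  encodeList (z ∷ zs) = suc (cantor (encodeℤ z) (encodeList zs))

  -- The first argument is fuel; a code is never smaller than the code of its tail.
  decodeListWithin : ℕ → ℕ → List ℤ
  decodeListWithin zero    _       = []
  decodeListWithin (suc f) zero    = []
  decodeListWithin (suc f) (suc k) with uncantor k
  ... | a , b = decodeℤ a ∷ decodeListWithin f b

  decodeListWithin-encodeList : ∀ zs f → encodeList zs ≤ f →
                                decodeListWithin f (encodeList zs) ≡ zs
  decodeListWithin-encodeList []       zero    _ = refl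
  decodeListWithin-encodeList []       (suc f) _ = refl
  decodeListWithin-encodeList (z ∷ zs) (suc f) (s≤s le)
    rewrite uncantor-cantor (encodeℤ z) (encodeList zs) | decodeℤ-encodeℤ z
    = cong (z ∷_) (decodeListWithin-encodeList zs f
                     (≤-trans (n≤cantor (encodeℤ z) (encodeList zs)) le))

  decodeList : ℕ → List ℤ
  decodeList k = decodeListWithin k k

  decodeList-encodeList : ∀ zs → decodeList (encodeList zs) ≡ zs
  decodeList-encodeList zs = decodeListWithin-encodeList zs _ ≤-refl

module Search where

  open import Data.Nat using (ℕ; zero; suc; _≤_; _<_; _≟_)
  open import Data.Nat.Properties using (≤-refl; <⇒≤; m<n⇒m<1+n; ≤∧≢⇒<; ≤-pred)
  open import Data.Product using (_×_; _,_; ∃-syntax)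
  open import Data.Sum using (_⊎_; inj₁; inj₂)
  open import Relation.Nullary using (¬_; yes; no)
  open import Level using (0ℓ)
  open import Relation.Unary using (Pred; Decidable)
  open import Relation.Binary.PropositionalEquality using (refl)

  Minimal : Pred ℕ 0ℓ → ℕ → Set
  Minimal P j = P j × (∀ k → k < j → ¬ P k)

  module _ {P : Pred ℕ 0ℓ} (P? : Decidable P) where

    search< : ∀ n → (∃[ i ] (i < n × Minimal P i)) ⊎ (∀ i → i < n → ¬ P i)
    search< zero = inj₂ λ _ ()
    search< (suc n) with search< n
    ... | inj₁ (i , i<n , min) = inj₁ (i , m<n⇒m<1+n i<n , min)
    ... | inj₂ none with P? n
    ...   | yes p = inj₁ (n , ≤-refl , p , none)
    ...   | no ¬p = inj₂ none≤n
      where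
      none≤n : ∀ i → i < suc n → ¬ P i
      none≤n i i<1+n with i ≟ n
      ... | yes refl = ¬p
      ... | no i≢n   = none i (≤∧≢⇒< (≤-pred i<1+n) i≢n)

    minimal : ∀ {i} → P i → ∃[ j ] (j ≤ i × Minimal P j)
    minimal {i} p with search< i
    ... | inj₁ (j , j<i , min) = j , <⇒≤ j<i , min
    ... | inj₂ none            = i , ≤-refl , p , none

module Countable where

  open import Level using (0ℓ)
  open import Data.Nat as ℕ using (ℕ; zero; suc; _∸_; _≤_; _<_; z≤n; s≤s; _≟_; _<?_; _≤?_)
  open import Data.Nat.Properties
  open import Data.Product using (_×_; _,_; proj₁; proj₂; ∃-syntax)
  open import Data.Sum using (inj₁; inj₂)
  open import Data.Empty using (⊥-elim)
  open import Relation.Nullary using (¬_; Dec; yes; no)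
  open import Relation.Nullary.Decidable using (_×-dec_)
  open import Relation.Binary using (Decidable)
  open import Relation.Binary.PropositionalEquality
    using (_≡_; _≢_; refl; sym; cong; subst)
  open import Relation.Binary.Definitions using (tri<; tri≈; tri>)
  open import Algebra.Bundles using (CommutativeRing; RawRing)
  open import Algebra.Morphism.Structures using (IsRingMonomorphism)
  import Algebra.Morphism.RingMonomorphism as RingMonomorphism
  open import Defs using (FieldOnℕ)
  open Search

  record CountableField : Set₁ where
    field
      commutativeRing : CommutativeRing 0ℓ 0ℓ

    open CommutativeRing commutativeRing public

    -- enum is onto up to ≈; embed witnesses that the field is infinite.
    field
      _≈?_      : Decidable _≈_
      0≉1       : ¬ (0# ≈ 1#)
      *-inverse : ∀ x → ¬ (x ≈ 0#) → ∃[ y ] (x * y ≈ 1#)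
      enum       : ℕ → Carrier
      index      : Carrier → ℕ
      enum-index : ∀ x → enum (index x) ≈ x
      embed           : ℕ → Carrier
      embed-injective : ∀ {m n} → embed m ≈ embed n → m ≡ n

  prefixed : {A : Set} → ℕ → (ℕ → A) → (ℕ → A) → ℕ → A
  prefixed M v e i with i <? M
  ... | yes _ = v i
  ... | no  _ = e (i ∸ M)

  prefixed-< : ∀ {A : Set} M (v e : ℕ → A) {i} → i < M → prefixed M v e i ≡ v i
  prefixed-< M v e {i} i<M with i <? M
  ... | yes _   = refl
  ... | no  i≮M = ⊥-elim (i≮M i<M)

  prefixed-+ : ∀ {A : Set} M (v e : ℕ → A) i → prefixed M v e (M ℕ.+ i) ≡ e i
  prefixed-+ M v e i with M ℕ.+ i <? M
  ... | yes M+i<M = ⊥-elim (m+n≮m M i M+i<M)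
  ... | no  _     = cong e (m+n∸m≡n M i)

  -- Listing each element once, at its first index in enum, gives a bijection element : ℕ → F,
  -- along which the field structure is transported.
  module OnNaturals (F : CountableField) where

    open CountableField F renaming (refl to ≈-refl; sym to ≈-sym; trans to ≈-trans)

    pigeonhole : ∀ n (f : ℕ → Carrier) →
                 ∃[ m ] (m ≤ n × ∀ i → i < n → ¬ (f i ≈ embed m))
    pigeonhole zero f = 0 , z≤n , λ _ ()
    pigeonhole (suc n) f with search< (λ i → f i ≈? embed (suc n)) (suc n)
    ... | inj₂ none = suc n , ≤-refl , none
    ... | inj₁ (i₀ , i₀≤n , fi₀≈ , _) = m , m≤n⇒m≤1+n m≤n , avoids
      where
      -- f i₀ hits embed (suc n); moving f n to position i₀ lets the induction hypothesis cover f.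
      f′ : ℕ → Carrier
      f′ i with i ≟ i₀
      ... | yes _ = f n
      ... | no  _ = f i

      m = proj₁ (pigeonhole n f′)
      m≤n = proj₁ (proj₂ (pigeonhole n f′))
      avoids′ = proj₂ (proj₂ (pigeonhole n f′))

      f′-away : ∀ {i} → i ≢ i₀ → f′ i ≡ f i
      f′-away {i} i≢i₀ with i ≟ i₀
      ... | yes i≡i₀ = ⊥-elim (i≢i₀ i≡i₀)
      ... | no  _    = refl

      f′-at : f′ i₀ ≡ f n
      f′-at with i₀ ≟ i₀
      ... | yes _ = refl
      ... | no  ¬refl = ⊥-elim (¬refl refl)

      avoids : ∀ i → i < suc n → ¬ (f i ≈ embed m)
      avoids i i<1+n fi≈ with i ≟ i₀ | i ≟ n
      ... | yes refl | _ = <⇒≢ (s≤s m≤n) (embed-injective (≈-trans (≈-sym fi≈) fi₀≈))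
      ... | no i≢i₀ | no i≢n =
        avoids′ i (≤∧≢⇒< (≤-pred i<1+n) i≢n) (subst (_≈ embed m) (sym (f′-away i≢i₀)) fi≈)
      ... | no i≢i₀ | yes refl =
        avoids′ i₀ (≤∧≢⇒< (≤-pred i₀≤n) (λ i₀≡i → i≢i₀ (sym i₀≡i)))
                (subst (_≈ embed m) (sym f′-at) fi≈)

    Canonical : ℕ → Set
    Canonical i = ∀ j → j < i → ¬ (enum j ≈ enum i)

    canonical? : ∀ i → Dec (Canonical i)
    canonical? i with search< (λ j → enum j ≈? enum i) i
    ... | inj₁ (j , j<i , ej≈ei , _) = no λ can → can j j<i ej≈ei
    ... | inj₂ none = yes none

    canonical-index : ∀ a → ∃[ j ] (Canonical j × enum j ≈ a)
    canonical-index a with minimal (λ k → enum k ≈? a) (enum-index a)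
    ... | j , _ , ej≈a , below =
      j , (λ k k<j ek≈ej → below k k<j (≈-trans ek≈ej ej≈a)) , ej≈a

    canonical-above : ∀ n → ∃[ j ] (Canonical j × n < j)
    canonical-above n with pigeonhole (suc n) enum
    ... | m , _ , avoids with canonical-index (embed m)
    ...   | j , can , ej≈ = j , can , n<j
      where
      n<j : n < j
      n<j with n <? j
      ... | yes n<j = n<j
      ... | no  n≮j = ⊥-elim (avoids j (s≤s (≮⇒≥ n≮j)) ej≈)

    CanonicalAbove : ℕ → ℕ → Set
    CanonicalAbove n j = Canonical j × n < j

    nextCanonical : ∀ n → ∃[ j ] (j ≤ proj₁ (canonical-above n) × Minimal (CanonicalAbove n) j)
    nextCanonical n = minimal (λ j → canonical? j ×-dec n <? j) (proj₂ (canonical-above n))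

    abstract
      -- canonical k is the k-th index at which enum reaches a new element.
      canonical : ℕ → ℕ
      canonical zero    = 0
      canonical (suc k) = proj₁ (nextCanonical (canonical k))

      canonical-next : ∀ k → Minimal (CanonicalAbove (canonical k)) (canonical (suc k))
      canonical-next k = proj₂ (proj₂ (nextCanonical (canonical k)))

      canonical-isCanonical : ∀ k → Canonical (canonical k)
      canonical-isCanonical zero    _ ()
      canonical-isCanonical (suc k) = proj₁ (proj₁ (canonical-next k))

      canonical-< : ∀ k → canonical k < canonical (suc k)
      canonical-< k = proj₂ (proj₁ (canonical-next k))

      canonical-strictMono : ∀ {a b} → a < b → canonical a < canonical b
      canonical-strictMono {a} {suc b} (s≤s a≤b) with a ≟ b
      ... | yes refl = canonical-< a
      ... | no  a≢b  = <-trans (canonical-strictMono (≤∧≢⇒< a≤b a≢b)) (canonical-< b)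

      n≤canonical : ∀ k → k ≤ canonical k
      n≤canonical zero    = z≤n
      n≤canonical (suc k) = ≤-<-trans (n≤canonical k) (canonical-< k)

      canonical-below : ∀ k j → j ≤ canonical k → Canonical j → ∃[ k′ ] (canonical k′ ≡ j)
      canonical-below zero    zero    _  _   = 0 , refl
      canonical-below (suc k) j       j≤ can with j ≤? canonical k
      ... | yes j≤ck = canonical-below k j j≤ck can
      ... | no  j≰ck with j ≟ canonical (suc k)
      ...   | yes j≡ = suc k , sym j≡
      ...   | no  j≢ = ⊥-elim (proj₂ (canonical-next k) j (≤∧≢⇒< j≤ j≢) (can , ≰⇒> j≰ck))

      canonical-surjective : ∀ j → Canonical j → ∃[ k ] (canonical k ≡ j)
      canonical-surjective j = canonical-below j j (n≤canonical j)

      canonical-prefix : ∀ M → (∀ i j → i < j → j < M → ¬ (enum i ≈ enum j)) →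
                         ∀ k → k < M → canonical k ≡ k
      canonical-prefix M distinct zero    _ = refl
      canonical-prefix M distinct (suc k) k<M
        with canonical (suc k) ≟ suc k
      ... | yes eq = eq
      ... | no  ne = ⊥-elim (proj₂ (canonical-next k) (suc k) below (can , above))
        where
        ck≡k : canonical k ≡ k
        ck≡k = canonical-prefix M distinct k (<-trans (n<1+n k) k<M)
        can : Canonical (suc k)
        can i i<1+k = distinct i (suc k) i<1+k k<M
        above : canonical k < suc k
        above = subst (_< suc k) (sym ck≡k) ≤-refl
        below : suc k < canonical (suc k)
        below = ≤∧≢⇒< (subst (_< canonical (suc k)) ck≡k (canonical-< k)) (λ eq → ne (sym eq))

      element : ℕ → Carrier
      element k = enum (canonical k)

      position : Carrier → ℕ
      position a = proj₁ (canonical-surjective _ (proj₁ (proj₂ (canonical-index a))))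

      element-position : ∀ a → element (position a) ≈ a
      element-position a =
        subst (λ j → enum j ≈ a) (sym (proj₂ (canonical-surjective _ can))) (proj₂ (proj₂ (canonical-index a)))
        where
        can : Canonical (proj₁ (canonical-index a))
        can = proj₁ (proj₂ (canonical-index a))

      element-injective : ∀ {a b} → element a ≈ element b → a ≡ b
      element-injective {a} {b} eq with <-cmp a b
      ... | tri≈ _ a≡b _ = a≡b
      ... | tri< a<b _ _ = ⊥-elim (canonical-isCanonical b _ (canonical-strictMono a<b) eq)
      ... | tri> _ _ b<a = ⊥-elim (canonical-isCanonical a _ (canonical-strictMono b<a) (≈-sym eq))

      element-prefix : ∀ M → (∀ i j → i < j → j < M → ¬ (enum i ≈ enum j)) →
                       ∀ k → k < M → element k ≡ enum k
      element-prefix M distinct k k<M = cong enum (canonical-prefix M distinct k k<M)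

    ℕ-rawRing : RawRing 0ℓ 0ℓ
    ℕ-rawRing = record
      { Carrier = ℕ
      ; _≈_ = _≡_
      ; _+_ = λ a b → position (element a + element b)
      ; _*_ = λ a b → position (element a * element b)
      ; -_  = λ a → position (- element a)
      ; 0#  = position 0#
      ; 1#  = position 1#
      }

    element-isRingMonomorphism : IsRingMonomorphism ℕ-rawRing rawRing element
    element-isRingMonomorphism = record
      { isRingHomomorphism = record
        { isSemiringHomomorphism = record
          { isNearSemiringHomomorphism = record
            { +-isMonoidHomomorphism = record
              { isMagmaHomomorphism = record
                { isRelHomomorphism = record { cong = λ { refl → ≈-refl } }
                ; homo = λ _ _ → element-position _
                }
              ; ε-homo = element-position _
              }
            ; *-homo = λ _ _ → element-position _
            }
          ; 1#-homo = element-position _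
          }
        ; -‿homo = λ _ → element-position _
        }
      ; injective = element-injective
      }

    open IsRingMonomorphism element-isRingMonomorphism public
      using (+-homo; *-homo; -‿homo; 0#-homo; 1#-homo)

    fieldOnℕ : FieldOnℕ
    fieldOnℕ = record
      { isCommutativeRing =
          RingMonomorphism.isCommutativeRing element-isRingMonomorphism isCommutativeRing
      ; 0≢1 = λ eq → 0≉1 (≈-trans (≈-sym 0#-homo) (≈-trans (reflexive (cong element eq)) 1#-homo))
      ; inverse = λ x x≢0 → inverse x (λ x≈0 → x≢0 (element-injective (≈-trans x≈0 (≈-sym 0#-homo))))
      }
      where
      inverse : ∀ x → ¬ (element x ≈ 0#) → ∃[ y ] (position (element x * element y) ≡ position 1#)
      inverse x nz with *-inverse (element x) nz
      ... | y , xy≈1 = position y , element-injective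
            (≈-trans (element-position _)
            (≈-trans (*-cong ≈-refl (element-position y)) (≈-trans xy≈1 (≈-sym (element-position 1#)))))

module Eventually where

  open import Level using (0ℓ)
  open import Data.Nat using (ℕ; zero; suc; _≤_; _<_; _⊔_; _≟_)
  open import Data.Nat.Properties using (≤-refl; ≤-trans; m≤m⊔n; m≤n⊔m; m<n⇒m<1+n; ≤∧≢⇒<; ≤-pred)
  open import Data.Product using (_×_; _,_; ∃-syntax)
  open import Relation.Nullary using (yes; no)
  open import Relation.Unary using (Pred)
  open import Relation.Binary.PropositionalEquality using (refl)

  Eventually : Pred ℕ 0ℓ → Set
  Eventually P = ∃[ T ] (∀ N → T ≤ N → P N)

  module _ {P Q : Pred ℕ 0ℓ} where

    eventually-× : Eventually P → Eventually Q → Eventually (λ N → P N × Q N)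
    eventually-× (S , p) (T , q) =
      S ⊔ T , λ N le → p N (≤-trans (m≤m⊔n S T) le) , q N (≤-trans (m≤n⊔m S T) le)

  eventually-∀< : ∀ M {P : ℕ → Pred ℕ 0ℓ} → (∀ k → k < M → Eventually (P k)) →
                  Eventually (λ N → ∀ k → k < M → P k N)
  eventually-∀< zero    _ = 0 , λ _ _ _ ()
  eventually-∀< (suc M) {P} ev with ev M ≤-refl | eventually-∀< M (λ k k<M → ev k (m<n⇒m<1+n k<M))
  ... | S , p | T , q = S ⊔ T , all
    where
    all : ∀ N → S ⊔ T ≤ N → ∀ k → k < suc M → P k N
    all N le k k<1+M with k ≟ M
    ... | yes refl = p N (≤-trans (m≤m⊔n S T) le)
    ... | no  k≢M  = q N (≤-trans (m≤n⊔m S T) le) k (≤∧≢⇒< (≤-pred k<1+M) k≢M)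

module Evaluation where

  open import Level using (0ℓ)
  open import Data.Nat using (ℕ)
  open import Data.Integer using (ℤ; 0ℤ; 1ℤ)
  import Data.Integer as ℤ
  open import Relation.Nullary using (¬_; Dec)
  open import Relation.Unary using (Pred)
  open import Relation.Binary.PropositionalEquality using (_≡_; _≢_)
  open import Algebra.Core using (Op₁; Op₂)
  open Eventually

  -- Maps eval N : D → ℤ respecting the operations, which jointly detect zero: either d is zero
  -- or eval N d ≢ 0 for all large N. No laws are required of D itself, since those of its field of
  -- fractions are checked after evaluation in ℤ.
  record EvalDomain : Set₁ where
    field
      Carrier : Set
      _+_ _*_ : Op₂ Carrier
      -_      : Op₁ Carrier
      0# 1#   : Carrier
      const   : ℤ → Carrier
      eval    : ℕ → Carrier → ℤ
      eval-+     : ∀ N a b → eval N (a + b) ≡ eval N a ℤ.+ eval N b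
      eval-*     : ∀ N a b → eval N (a * b) ≡ eval N a ℤ.* eval N b
      eval--     : ∀ N a → eval N (- a) ≡ ℤ.- eval N a
      eval-0     : ∀ N → eval N 0# ≡ 0ℤ
      eval-1     : ∀ N → eval N 1# ≡ 1ℤ
      eval-const : ∀ N z → eval N (const z) ≡ z
      IsZero  : Pred Carrier 0ℓ
      isZero? : ∀ d → Dec (IsZero d)
      isZero⇒eval≡0 : ∀ {d} → IsZero d → ∀ N → eval N d ≡ 0ℤ
      ¬isZero⇒eventually≢0 : ∀ {d} → ¬ IsZero d → Eventually (λ N → eval N d ≢ 0ℤ)
      enum       : ℕ → Carrier
      index      : Carrier → ℕ
      enum-index : ∀ d → enum (index d) ≡ d

module Fraction (E : Evaluation.EvalDomain) where

  open Evaluation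

  open import Level using (0ℓ)
  open import Data.Nat as ℕ using (ℕ; zero; suc)
  open import Data.Nat.Properties as ℕ using (≤-refl)
  open import Data.Integer using (ℤ; +_; -[1+_]; _+_; _*_; -_; _-_; 0ℤ; 1ℤ)
  open import Data.Integer.Properties as ℤ using (*-cancelʳ-≡; i*j≡0⇒i≡0∨j≡0; i-j≡0⇒i≡j; i≡j⇒i-j≡0)
  import Data.Integer.Base as ℤ
  open import Data.Integer.Tactic.RingSolver
  open import Data.List using ([]; _∷_)
  open import Data.Product using (Σ; _,_; proj₁; proj₂; ∃-syntax)
  open import Data.Sum using (inj₁; inj₂)
  open import Data.Empty using (⊥-elim)
  open import Relation.Nullary using (¬_; Dec; yes; no)
  open import Relation.Binary using (Setoid; IsEquivalence)
  open import Relation.Binary.PropositionalEquality as ≡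
    using (_≡_; _≢_; refl; cong; cong₂; module ≡-Reasoning)
  open import Algebra.Structures using (IsCommutativeRing)
  open import Algebra.Bundles using (CommutativeRing)
  import Algebra.Consequences.Setoid as Consequences
  open Coding using (cantor; uncantor; uncantor-cantor)
  open import Defs using (FieldOnℕ)
  open Eventually
  open Countable

  open EvalDomain E renaming
    ( Carrier to D; _+_ to _+ᴰ_; _*_ to _*ᴰ_; -_ to -ᴰ_; 0# to 0ᴰ; 1# to 1ᴰ
    ; enum to enumᴰ; index to indexᴰ; enum-index to enumᴰ-indexᴰ)

  1ᴰ≉0 : ¬ IsZero 1ᴰ
  1ᴰ≉0 z with ≡.trans (≡.sym (eval-1 0)) (isZero⇒eval≡0 z 0)
  ... | ()

  eventually≡0⇒isZero : ∀ {d} → Eventually (λ N → eval N d ≡ 0ℤ) → IsZero d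
  eventually≡0⇒isZero {d} ev with isZero? d
  ... | yes z = z
  ... | no ¬z with eventually-× ev (¬isZero⇒eventually≢0 ¬z)
  ...   | T , both = ⊥-elim (proj₂ (both T ≤-refl) (proj₁ (both T ≤-refl)))

  *ᴰ-¬isZero : ∀ {a b} → ¬ IsZero a → ¬ IsZero b → ¬ IsZero (a *ᴰ b)
  *ᴰ-¬isZero {a} {b} a≉0 b≉0 ab≈0
    with eventually-× (¬isZero⇒eventually≢0 a≉0) (¬isZero⇒eventually≢0 b≉0)
  ... | T , both with i*j≡0⇒i≡0∨j≡0 (eval T a)
                        (≡.trans (≡.sym (eval-* T a b)) (isZero⇒eval≡0 ab≈0 T))
  ...   | inj₁ a≡0 = proj₁ (both T ≤-refl) a≡0
  ...   | inj₂ b≡0 = proj₂ (both T ≤-refl) b≡0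

  record Fraction : Set where
    constructor fraction
    field
      num den : D
      den≉0   : ¬ IsZero den

  open Fraction public

  numAt denAt : ℕ → Fraction → ℤ
  numAt N x = eval N (num x)
  denAt N x = eval N (den x)

  eventually-denAt≢0 : ∀ x → Eventually (λ N → denAt N x ≢ 0ℤ)
  eventually-denAt≢0 x = ¬isZero⇒eventually≢0 (den≉0 x)

  Cross : ℕ → Fraction → Fraction → Set
  Cross N x y = numAt N x * denAt N y ≡ numAt N y * denAt N x

  crossDifference : Fraction → Fraction → D
  crossDifference x y = (num x *ᴰ den y) +ᴰ (-ᴰ (num y *ᴰ den x))

  eval-crossDifference : ∀ N x y →
    eval N (crossDifference x y) ≡ numAt N x * denAt N y - numAt N y * denAt N x
  eval-crossDifference N x y = ≡.trans (eval-+ N _ _)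
    (cong₂ _+_ (eval-* N _ _) (≡.trans (eval-- N _) (cong -_ (eval-* N _ _))))

  infix 4 _≈_
  record _≈_ (x y : Fraction) : Set where
    constructor byCrossDifference
    field isZero-crossDifference : IsZero (crossDifference x y)

  ≈⇒Cross : ∀ {x y} → x ≈ y → ∀ N → Cross N x y
  ≈⇒Cross {x} {y} (byCrossDifference z) N = i-j≡0⇒i≡j _ _
    (≡.trans (≡.sym (eval-crossDifference N x y)) (isZero⇒eval≡0 z N))

  eventuallyCross⇒≈ : ∀ {x y} → Eventually (λ N → Cross N x y) → x ≈ y
  eventuallyCross⇒≈ {x} {y} (T , cross) = byCrossDifference (eventually≡0⇒isZero
    (T , λ N T≤N → ≡.trans (eval-crossDifference N x y) (i≡j⇒i-j≡0 (cross N T≤N))))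

  Cross⇒≈ : ∀ {x y} → (∀ N → Cross N x y) → x ≈ y
  Cross⇒≈ cross = eventuallyCross⇒≈ (0 , λ N _ → cross N)

  ≉⇒eventually-¬Cross : ∀ {x y} → ¬ (x ≈ y) → Eventually (λ N → ¬ Cross N x y)
  ≉⇒eventually-¬Cross {x} {y} x≉y with ¬isZero⇒eventually≢0 (λ z → x≉y (byCrossDifference z))
  ... | T , ≢0 = T , λ N T≤N cross →
        ≢0 N T≤N (≡.trans (eval-crossDifference N x y) (i≡j⇒i-j≡0 cross))

  _≈?_ : ∀ x y → Dec (x ≈ y)
  x ≈? y with isZero? (crossDifference x y)
  ... | yes z = yes (byCrossDifference z)
  ... | no ¬z = no λ (byCrossDifference z) → ¬z z

  cross-by : ∀ {a b c d a′ b′ c′ d′ : ℤ} → a ≡ a′ → b ≡ b′ → c ≡ c′ → d ≡ d′ →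
             a′ * b′ ≡ c′ * d′ → a * b ≡ c * d
  cross-by refl refl refl refl eq = eq

  infixl 6 _⊕_
  infixl 7 _⊗_
  infix  8 ⊖_

  _⊕_ _⊗_ : Fraction → Fraction → Fraction
  x ⊕ y = fraction ((num x *ᴰ den y) +ᴰ (num y *ᴰ den x)) (den x *ᴰ den y)
                   (*ᴰ-¬isZero (den≉0 x) (den≉0 y))
  x ⊗ y = fraction (num x *ᴰ num y) (den x *ᴰ den y) (*ᴰ-¬isZero (den≉0 x) (den≉0 y))

  ⊖_ : Fraction → Fraction
  ⊖ x = fraction (-ᴰ num x) (den x) (den≉0 x)

  𝟎 𝟏 : Fraction
  𝟎 = fraction 0ᴰ 1ᴰ 1ᴰ≉0
  𝟏 = fraction 1ᴰ 1ᴰ 1ᴰ≉0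

  numAt-⊕ : ∀ N x y → numAt N (x ⊕ y) ≡ numAt N x * denAt N y + numAt N y * denAt N x
  numAt-⊕ N x y = ≡.trans (eval-+ N _ _) (cong₂ _+_ (eval-* N _ _) (eval-* N _ _))

  denAt-⊕ : ∀ N x y → denAt N (x ⊕ y) ≡ denAt N x * denAt N y
  denAt-⊕ N x y = eval-* N _ _

  numAt-⊗ : ∀ N x y → numAt N (x ⊗ y) ≡ numAt N x * numAt N y
  numAt-⊗ N x y = eval-* N _ _

  denAt-⊗ : ∀ N x y → denAt N (x ⊗ y) ≡ denAt N x * denAt N y
  denAt-⊗ N x y = eval-* N _ _

  numAt-⊖ : ∀ N x → numAt N (⊖ x) ≡ - numAt N x
  numAt-⊖ N x = eval-- N _

  ≈-refl : ∀ {x} → x ≈ x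
  ≈-refl = Cross⇒≈ λ _ → refl

  ≈-sym : ∀ {x y} → x ≈ y → y ≈ x
  ≈-sym x≈y = Cross⇒≈ λ N → ≡.sym (≈⇒Cross x≈y N)

  -- Cancelling by the denominator of y is only possible where it does not vanish.
  ≈-trans : ∀ {x y z} → x ≈ y → y ≈ z → x ≈ z
  ≈-trans {x} {y} {z} x≈y y≈z with eventually-denAt≢0 y
  ... | T , y≢0 = eventuallyCross⇒≈ (T , λ N T≤N →
        cancel (numAt N x) (denAt N x) (numAt N y) (denAt N y) (numAt N z) (denAt N z)
               (y≢0 N T≤N) (≈⇒Cross x≈y N) (≈⇒Cross y≈z N))
    where
    cancel : ∀ a b c d e f → d ≢ 0ℤ → a * d ≡ c * b → c * f ≡ e * d → a * f ≡ e * b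
    cancel a b c d e f d≢0 p q = *-cancelʳ-≡ (a * f) (e * b) d {{ℤ.≢-nonZero d≢0}} (begin
      a * f * d   ≡⟨ solve (a ∷ f ∷ d ∷ []) ⟩
      (a * d) * f ≡⟨ cong (_* f) p ⟩
      (c * b) * f ≡⟨ solve (c ∷ b ∷ f ∷ []) ⟩
      (c * f) * b ≡⟨ cong (_* b) q ⟩
      (e * d) * b ≡⟨ solve (e ∷ d ∷ b ∷ []) ⟩
      e * b * d   ∎)
      where open ≡-Reasoning

  infixr 5 _∙_
  _∙_ : ∀ {x y z} → x ≈ y → y ≈ z → x ≈ z
  _∙_ = ≈-trans

  ≈-reflexive : ∀ {x y} → x ≡ y → x ≈ y
  ≈-reflexive refl = ≈-refl

  ≈-isEquivalence : IsEquivalence _≈_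
  ≈-isEquivalence = record { refl = ≈-refl ; sym = ≈-sym ; trans = ≈-trans }

  ⊕-cong : ∀ {x x′ y y′} → x ≈ x′ → y ≈ y′ → x ⊕ y ≈ x′ ⊕ y′
  ⊕-cong {x} {x′} {y} {y′} p q = Cross⇒≈ λ N →
    cross-by (numAt-⊕ N x y) (denAt-⊕ N x′ y′) (numAt-⊕ N x′ y′) (denAt-⊕ N x y)
      (lemma (numAt N x) (denAt N x) (numAt N y) (denAt N y)
             (numAt N x′) (denAt N x′) (numAt N y′) (denAt N y′) (≈⇒Cross p N) (≈⇒Cross q N))
    where
    lemma : ∀ a b c d a′ b′ c′ d′ → a * b′ ≡ a′ * b → c * d′ ≡ c′ * d →
            (a * d + c * b) * (b′ * d′) ≡ (a′ * d′ + c′ * b′) * (b * d)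
    lemma a b c d a′ b′ c′ d′ p q = begin
      (a * d + c * b) * (b′ * d′)               ≡⟨ solve (a ∷ b ∷ c ∷ d ∷ b′ ∷ d′ ∷ []) ⟩
      (a * b′) * (d * d′) + (c * d′) * (b * b′) ≡⟨ cong₂ (λ u v → u * (d * d′) + v * (b * b′)) p q ⟩
      (a′ * b) * (d * d′) + (c′ * d) * (b * b′) ≡⟨ solve (a′ ∷ b ∷ c′ ∷ d ∷ b′ ∷ d′ ∷ []) ⟩
      (a′ * d′ + c′ * b′) * (b * d)             ∎
      where open ≡-Reasoning

  ⊗-cong : ∀ {x x′ y y′} → x ≈ x′ → y ≈ y′ → x ⊗ y ≈ x′ ⊗ y′
  ⊗-cong {x} {x′} {y} {y′} p q = Cross⇒≈ λ N →
    cross-by (numAt-⊗ N x y) (denAt-⊗ N x′ y′) (numAt-⊗ N x′ y′) (denAt-⊗ N x y)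
      (lemma (numAt N x) (denAt N x) (numAt N y) (denAt N y)
             (numAt N x′) (denAt N x′) (numAt N y′) (denAt N y′) (≈⇒Cross p N) (≈⇒Cross q N))
    where
    lemma : ∀ a b c d a′ b′ c′ d′ → a * b′ ≡ a′ * b → c * d′ ≡ c′ * d →
            (a * c) * (b′ * d′) ≡ (a′ * c′) * (b * d)
    lemma a b c d a′ b′ c′ d′ p q = begin
      (a * c) * (b′ * d′) ≡⟨ solve (a ∷ c ∷ b′ ∷ d′ ∷ []) ⟩
      (a * b′) * (c * d′) ≡⟨ cong₂ _*_ p q ⟩
      (a′ * b) * (c′ * d) ≡⟨ solve (a′ ∷ b ∷ c′ ∷ d ∷ []) ⟩
      (a′ * c′) * (b * d) ∎
      where open ≡-Reasoning

  ⊖-cong : ∀ {x x′} → x ≈ x′ → ⊖ x ≈ ⊖ x′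
  ⊖-cong {x} {x′} p = Cross⇒≈ λ N →
    cross-by (numAt-⊖ N x) refl (numAt-⊖ N x′) refl
      (lemma (numAt N x) (denAt N x) (numAt N x′) (denAt N x′) (≈⇒Cross p N))
    where
    lemma : ∀ a b a′ b′ → a * b′ ≡ a′ * b → (- a) * b′ ≡ (- a′) * b
    lemma a b a′ b′ p = begin
      (- a) * b′ ≡⟨ solve (a ∷ b′ ∷ []) ⟩
      - (a * b′) ≡⟨ cong -_ p ⟩
      - (a′ * b) ≡⟨ solve (a′ ∷ b ∷ []) ⟩
      (- a′) * b ∎
      where open ≡-Reasoning

  ⊕-assoc : ∀ x y z → (x ⊕ y) ⊕ z ≈ x ⊕ (y ⊕ z)
  ⊕-assoc x y z = Cross⇒≈ λ N → cross-by
    (≡.trans (numAt-⊕ N (x ⊕ y) z)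
             (cong₂ (λ u v → u * denAt N z + numAt N z * v) (numAt-⊕ N x y) (denAt-⊕ N x y)))
    (≡.trans (denAt-⊕ N x (y ⊕ z)) (cong (denAt N x *_) (denAt-⊕ N y z)))
    (≡.trans (numAt-⊕ N x (y ⊕ z))
             (cong₂ (λ u v → numAt N x * u + v * denAt N x) (denAt-⊕ N y z) (numAt-⊕ N y z)))
    (≡.trans (denAt-⊕ N (x ⊕ y) z) (cong (_* denAt N z) (denAt-⊕ N x y)))
    (identity (numAt N x) (denAt N x) (numAt N y) (denAt N y) (numAt N z) (denAt N z))
    where
    identity : ∀ a b c d e f → ((a * d + c * b) * f + e * (b * d)) * (b * (d * f))
                             ≡ (a * (d * f) + (c * f + e * d) * b) * ((b * d) * f)
    identity = solve-∀

  ⊕-comm : ∀ x y → x ⊕ y ≈ y ⊕ x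
  ⊕-comm x y = Cross⇒≈ λ N →
    cross-by (numAt-⊕ N x y) (denAt-⊕ N y x) (numAt-⊕ N y x) (denAt-⊕ N x y)
      (identity (numAt N x) (denAt N x) (numAt N y) (denAt N y))
    where
    identity : ∀ a b c d → (a * d + c * b) * (d * b) ≡ (c * b + a * d) * (b * d)
    identity = solve-∀

  ⊕-identityˡ : ∀ x → 𝟎 ⊕ x ≈ x
  ⊕-identityˡ x = Cross⇒≈ λ N → cross-by
    (≡.trans (numAt-⊕ N 𝟎 x) (cong₂ (λ u v → u * denAt N x + numAt N x * v) (eval-0 N) (eval-1 N)))
    (≡.refl {x = denAt N x}) (≡.refl {x = numAt N x})
    (≡.trans (denAt-⊕ N 𝟎 x) (cong (_* denAt N x) (eval-1 N)))
    (identity (numAt N x) (denAt N x))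
    where
    identity : ∀ a b → (0ℤ * b + a * 1ℤ) * b ≡ a * (1ℤ * b)
    identity = solve-∀

  ⊖-inverseˡ : ∀ x → ⊖ x ⊕ x ≈ 𝟎
  ⊖-inverseˡ x = Cross⇒≈ λ N → cross-by
    (≡.trans (numAt-⊕ N (⊖ x) x) (cong (λ u → u * denAt N x + numAt N x * denAt N x) (numAt-⊖ N x)))
    (eval-1 N) (eval-0 N) (denAt-⊕ N (⊖ x) x)
    (identity (numAt N x) (denAt N x))
    where
    identity : ∀ a b → ((- a) * b + a * b) * 1ℤ ≡ 0ℤ * (b * b)
    identity = solve-∀

  ⊗-assoc : ∀ x y z → (x ⊗ y) ⊗ z ≈ x ⊗ (y ⊗ z)
  ⊗-assoc x y z = Cross⇒≈ λ N → cross-by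
    (≡.trans (numAt-⊗ N (x ⊗ y) z) (cong (_* numAt N z) (numAt-⊗ N x y)))
    (≡.trans (denAt-⊗ N x (y ⊗ z)) (cong (denAt N x *_) (denAt-⊗ N y z)))
    (≡.trans (numAt-⊗ N x (y ⊗ z)) (cong (numAt N x *_) (numAt-⊗ N y z)))
    (≡.trans (denAt-⊗ N (x ⊗ y) z) (cong (_* denAt N z) (denAt-⊗ N x y)))
    (identity (numAt N x) (denAt N x) (numAt N y) (denAt N y) (numAt N z) (denAt N z))
    where
    identity : ∀ a b c d e f → ((a * c) * e) * (b * (d * f)) ≡ (a * (c * e)) * ((b * d) * f)
    identity = solve-∀

  ⊗-comm : ∀ x y → x ⊗ y ≈ y ⊗ x
  ⊗-comm x y = Cross⇒≈ λ N →
    cross-by (numAt-⊗ N x y) (denAt-⊗ N y x) (numAt-⊗ N y x) (denAt-⊗ N x y)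
      (identity (numAt N x) (denAt N x) (numAt N y) (denAt N y))
    where
    identity : ∀ a b c d → (a * c) * (d * b) ≡ (c * a) * (b * d)
    identity = solve-∀

  ⊗-identityˡ : ∀ x → 𝟏 ⊗ x ≈ x
  ⊗-identityˡ x = Cross⇒≈ λ N → cross-by
    (≡.trans (numAt-⊗ N 𝟏 x) (cong (_* numAt N x) (eval-1 N)))
    (≡.refl {x = denAt N x}) (≡.refl {x = numAt N x})
    (≡.trans (denAt-⊗ N 𝟏 x) (cong (_* denAt N x) (eval-1 N)))
    (identity (numAt N x) (denAt N x))
    where
    identity : ∀ a b → (1ℤ * a) * b ≡ a * (1ℤ * b)
    identity = solve-∀

  ⊗-distribˡ-⊕ : ∀ x y z → x ⊗ (y ⊕ z) ≈ x ⊗ y ⊕ x ⊗ z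
  ⊗-distribˡ-⊕ x y z = Cross⇒≈ λ N → cross-by
    (≡.trans (numAt-⊗ N x (y ⊕ z)) (cong (numAt N x *_) (numAt-⊕ N y z)))
    (≡.trans (denAt-⊕ N (x ⊗ y) (x ⊗ z)) (cong₂ _*_ (denAt-⊗ N x y) (denAt-⊗ N x z)))
    (≡.trans (numAt-⊕ N (x ⊗ y) (x ⊗ z))
             (cong₂ _+_ (cong₂ _*_ (numAt-⊗ N x y) (denAt-⊗ N x z))
                        (cong₂ _*_ (numAt-⊗ N x z) (denAt-⊗ N x y))))
    (≡.trans (denAt-⊗ N x (y ⊕ z)) (cong (denAt N x *_) (denAt-⊕ N y z)))
    (identity (numAt N x) (denAt N x) (numAt N y) (denAt N y) (numAt N z) (denAt N z))
    where
    identity : ∀ a b c d e f → (a * (c * f + e * d)) * ((b * d) * (b * f))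
                             ≡ ((a * c) * (b * f) + (a * e) * (b * d)) * (b * (d * f))
    identity = solve-∀

  setoid : Setoid 0ℓ 0ℓ
  setoid = record { isEquivalence = ≈-isEquivalence }

  open Consequences setoid using (comm∧idˡ⇒id; comm∧invˡ⇒inv; comm∧distrˡ⇒distr)

  isCommutativeRing : IsCommutativeRing _≈_ _⊕_ _⊗_ ⊖_ 𝟎 𝟏
  isCommutativeRing = record
    { isRing = record
      { +-isAbelianGroup = record
        { isGroup = record
          { isMonoid = record
            { isSemigroup = record
              { isMagma = record { isEquivalence = ≈-isEquivalence ; ∙-cong = ⊕-cong }
              ; assoc = ⊕-assoc }
            ; identity = comm∧idˡ⇒id {_⊕_} ⊕-comm {𝟎} ⊕-identityˡ }
          ; inverse = comm∧invˡ⇒inv {_⊕_} {⊖_} ⊕-comm ⊖-inverseˡ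
          ; ⁻¹-cong = ⊖-cong }
        ; comm = ⊕-comm }
      ; *-cong = ⊗-cong
      ; *-assoc = ⊗-assoc
      ; *-identity = comm∧idˡ⇒id {_⊗_} ⊗-comm {𝟏} ⊗-identityˡ
      ; distrib = comm∧distrˡ⇒distr {_⊗_} {_⊕_} ⊕-cong ⊗-comm ⊗-distribˡ-⊕ }
    ; *-comm = ⊗-comm }

  commutativeRing : CommutativeRing 0ℓ 0ℓ
  commutativeRing = record { isCommutativeRing = isCommutativeRing }

  𝟎≉𝟏 : ¬ (𝟎 ≈ 𝟏)
  𝟎≉𝟏 𝟎≈𝟏 with cross-by (≡.sym (eval-0 0)) (≡.sym (eval-1 0)) (≡.sym (eval-1 0)) (≡.sym (eval-1 0))
                        (≈⇒Cross 𝟎≈𝟏 0)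
  ... | ()

  isZero-num⇒≈𝟎 : ∀ x → IsZero (num x) → x ≈ 𝟎
  isZero-num⇒≈𝟎 x z = Cross⇒≈ λ N →
    cross-by (isZero⇒eval≡0 z N) (eval-1 N) (eval-0 N) (≡.refl {x = denAt N x})
             (≡.sym (ℤ.*-zeroˡ (denAt N x)))

  ≈𝟎⇒isZero-num : ∀ x → x ≈ 𝟎 → IsZero (num x)
  ≈𝟎⇒isZero-num x x≈𝟎 = eventually≡0⇒isZero (0 , λ N _ → begin
    numAt N x       ≡⟨ ℤ.*-identityʳ _ ⟨
    numAt N x * 1ℤ  ≡⟨ cross-by (≡.refl {x = numAt N x}) (≡.sym (eval-1 N)) (≡.sym (eval-0 N))
                                (≡.refl {x = denAt N x}) (≈⇒Cross x≈𝟎 N) ⟩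
    0ℤ * denAt N x  ≡⟨ ℤ.*-zeroˡ (denAt N x) ⟩
    0ℤ              ∎)
    where open ≡-Reasoning

  ⊗-inverse : ∀ x → ¬ (x ≈ 𝟎) → ∃[ y ] (x ⊗ y ≈ 𝟏)
  ⊗-inverse x x≉𝟎 = y , Cross⇒≈ λ N →
    cross-by (numAt-⊗ N x y) (eval-1 N) (eval-1 N) (denAt-⊗ N x y)
             (identity (numAt N x) (denAt N x))
    where
    y = fraction (den x) (num x) (λ z → x≉𝟎 (isZero-num⇒≈𝟎 x z))
    identity : ∀ a b → (a * b) * 1ℤ ≡ 1ℤ * (b * a)
    identity = solve-∀

  const≉0 : ∀ {m} → m ≢ 0ℤ → ¬ IsZero (const m)
  const≉0 {m} m≢0 z = m≢0 (≡.trans (≡.sym (eval-const 0 m)) (isZero⇒eval≡0 z 0))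

  fromℤ : ℤ → Fraction
  fromℤ z = fraction (const z) 1ᴰ 1ᴰ≉0

  ratio : ℤ → (m : ℤ) → m ≢ 0ℤ → Fraction
  ratio α m m≢0 = fraction (const α) (const m) (const≉0 m≢0)

  fromℤ-0 : 𝟎 ≈ fromℤ 0ℤ
  fromℤ-0 = Cross⇒≈ λ N → cross-by (eval-0 N) (eval-1 N) (eval-const N 0ℤ) (eval-1 N) refl

  fromℤ-1 : 𝟏 ≈ fromℤ 1ℤ
  fromℤ-1 = Cross⇒≈ λ N → cross-by (eval-1 N) (eval-1 N) (eval-const N 1ℤ) (eval-1 N) refl

  fromℤ-+ : ∀ a b → fromℤ a ⊕ fromℤ b ≈ fromℤ (a + b)
  fromℤ-+ a b = Cross⇒≈ λ N → cross-by
    (≡.trans (numAt-⊕ N (fromℤ a) (fromℤ b))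
             (cong₂ _+_ (cong₂ _*_ (eval-const N a) (eval-1 N)) (cong₂ _*_ (eval-const N b) (eval-1 N))))
    (eval-1 N) (eval-const N (a + b))
    (≡.trans (denAt-⊕ N (fromℤ a) (fromℤ b)) (cong₂ _*_ (eval-1 N) (eval-1 N)))
    (identity a b)
    where
    identity : ∀ a b → (a * 1ℤ + b * 1ℤ) * 1ℤ ≡ (a + b) * (1ℤ * 1ℤ)
    identity = solve-∀

  fromℤ-- : ∀ a → ⊖ fromℤ a ≈ fromℤ (- a)
  fromℤ-- a = Cross⇒≈ λ N →
    cross-by (≡.trans (numAt-⊖ N (fromℤ a)) (cong -_ (eval-const N a))) (eval-1 N)
             (eval-const N (- a)) (eval-1 N) refl

  fromℤ-injective : ∀ {a b} → fromℤ a ≈ fromℤ b → a ≡ b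
  fromℤ-injective {a} {b} a≈b = begin
    a          ≡⟨ ℤ.*-identityʳ a ⟨
    a * 1ℤ     ≡⟨ cross-by (≡.sym (eval-const 0 a)) (≡.sym (eval-1 0)) (≡.sym (eval-const 0 b))
                           (≡.sym (eval-1 0)) (≈⇒Cross a≈b 0) ⟩
    b * 1ℤ     ≡⟨ ℤ.*-identityʳ b ⟩
    b          ∎
    where open ≡-Reasoning

  ⊗-fromℤ⇒≈ratio : ∀ x α m (m≢0 : m ≢ 0ℤ) → x ⊗ fromℤ m ≈ fromℤ α → x ≈ ratio α m m≢0
  ⊗-fromℤ⇒≈ratio x α m m≢0 eq = Cross⇒≈ λ N →
    cross-by (≡.refl {x = numAt N x}) (eval-const N m) (eval-const N α) (≡.refl {x = denAt N x})
      (begin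
        numAt N x * m           ≡⟨ ℤ.*-identityʳ _ ⟨
        numAt N x * m * 1ℤ      ≡⟨ cross-by
                                     (≡.sym (≡.trans (numAt-⊗ N x (fromℤ m)) (cong (numAt N x *_) (eval-const N m))))
                                     (≡.sym (eval-1 N)) (≡.sym (eval-const N α))
                                     (≡.sym (≡.trans (denAt-⊗ N x (fromℤ m)) (cong (denAt N x *_) (eval-1 N))))
                                     (≈⇒Cross eq N) ⟩
        α * (denAt N x * 1ℤ)    ≡⟨ cong (α *_) (ℤ.*-identityʳ _) ⟩
        α * denAt N x           ∎)
    where open ≡-Reasoning

  -- A zero denominator is replaced by 1, so that every code denotes some fraction.
  fromParts : D → D → Fraction
  fromParts p q with isZero? q
  ... | yes _  = fraction p 1ᴰ 1ᴰ≉0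
  ... | no q≉0 = fraction p q q≉0

  fromParts-num-den : ∀ x → fromParts (num x) (den x) ≈ x
  fromParts-num-den (fraction p q q≉0) with isZero? q
  ... | yes q≈0 = ⊥-elim (q≉0 q≈0)
  ... | no  _   = ≈-refl

  enum : ℕ → Fraction
  enum n = fromParts (enumᴰ (proj₁ (uncantor n))) (enumᴰ (proj₂ (uncantor n)))

  index : Fraction → ℕ
  index x = cantor (indexᴰ (num x)) (indexᴰ (den x))

  enum-index : ∀ x → enum (index x) ≈ x
  enum-index x rewrite uncantor-cantor (indexᴰ (num x)) (indexᴰ (den x))
                     | enumᴰ-indexᴰ (num x) | enumᴰ-indexᴰ (den x) = fromParts-num-den x

  countableFieldWith : (e : ℕ → Fraction) (i : Fraction → ℕ) → (∀ x → e (i x) ≈ x) → CountableField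
  countableFieldWith e i e-i = record
    { commutativeRing = commutativeRing
    ; _≈?_ = _≈?_
    ; 0≉1 = 𝟎≉𝟏
    ; *-inverse = ⊗-inverse
    ; enum = e
    ; index = i
    ; enum-index = e-i
    ; embed = λ m → fromℤ (+ m)
    ; embed-injective = λ eq → ℤ.+-injective (fromℤ-injective eq)
    }

  module Elements (e : ℕ → Fraction) (i : Fraction → ℕ) (e-i : ∀ x → e (i x) ≈ x) where

    open OnNaturals (countableFieldWith e i e-i) public
    open FieldOnℕ fieldOnℕ using (ι; InPrime) renaming (0# to 0#ᴷ; -_ to -ᴷ_)

    element-ι : ∀ n → element (ι n) ≈ fromℤ (+ n)
    element-ι zero    = 0#-homo ∙ fromℤ-0
    element-ι (suc n) = +-homo _ _ ∙ ⊕-cong (1#-homo ∙ fromℤ-1) (element-ι n) ∙ fromℤ-+ 1ℤ (+ n)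

    element≢0 : ∀ {c} → ¬ (element c ≈ 𝟎) → c ≢ 0#ᴷ
    element≢0 c≉𝟎 refl = c≉𝟎 0#-homo

    ι1≢0 : ι 1 ≢ 0#ᴷ
    ι1≢0 = element≢0 λ ι1≈𝟎 → 1≢0 (fromℤ-injective (≈-sym (element-ι 1) ∙ ι1≈𝟎 ∙ fromℤ-0))
      where
      1≢0 : + 1 ≢ 0ℤ
      1≢0 ()

    ℤ-as-difference : ∀ z → ∃[ a ] ∃[ b ] (+ a - + b ≡ z)
    ℤ-as-difference (+ n)    = n , 0 , ℤ.+-identityʳ (+ n)
    ℤ-as-difference -[1+ n ] = 0 , suc n , refl

    InPrime-position-fromℤ : ∀ z → InPrime (position (fromℤ z))
    InPrime-position-fromℤ z with ℤ-as-difference z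
    ... | a , b , a-b≡z = a , b , 1 , ι1≢0 , element-injective
      ( *-homo _ _ ∙ ⊗-cong (element-position _) (element-ι 1 ∙ ≈-sym fromℤ-1)
      ∙ ⊗-comm (fromℤ z) 𝟏 ∙ ⊗-identityˡ (fromℤ z)
      ∙ ≈-reflexive (cong fromℤ (≡.sym a-b≡z)) ∙ ≈-sym (fromℤ-+ (+ a) (- + b))
      ∙ ⊕-cong (≈-sym (element-ι a))
               (≈-sym (fromℤ-- (+ b)) ∙ ⊖-cong (≈-sym (element-ι b)) ∙ ≈-sym (-‿homo _))
      ∙ ≈-sym (+-homo (ι a) (-ᴷ ι b)))

    element-InPrime : ∀ {c} → InPrime c →
                      ∃[ α ] ∃[ m ] Σ (m ≢ 0ℤ) λ m≢0 → element c ≈ ratio α m m≢0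
    element-InPrime (_ , _ , zero , ι0≢0 , _) = ⊥-elim (ι0≢0 refl)
    element-InPrime {c} (a , b , suc m , _ , eq) =
      + a - + b , + suc m , (λ ()) , ⊗-fromℤ⇒≈ratio (element c) (+ a - + b) (+ suc m) (λ ()) ratio-eq
      where
      ratio-eq : element c ⊗ fromℤ (+ suc m) ≈ fromℤ (+ a - + b)
      ratio-eq = ⊗-cong (≈-refl {element c}) (≈-sym (element-ι (suc m))) ∙ ≈-sym (*-homo c (ι (suc m)))
               ∙ ≈-reflexive (cong element eq)
               ∙ +-homo (ι a) (-ᴷ ι b)
               ∙ ⊕-cong (element-ι a) (-‿homo _ ∙ ⊖-cong (element-ι b) ∙ fromℤ-- (+ b))
               ∙ fromℤ-+ (+ a) (- + b)

module Polynomial where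

  open import Data.Nat as ℕ using (ℕ; zero; suc; _≤_; _<_; s≤s)
  import Data.Nat.Properties as ℕ
  open import Data.Integer using (ℤ; +_; _+_; _*_; -_; 0ℤ; 1ℤ; ∣_∣)
  import Data.Integer.Properties as ℤ
  open import Data.Integer.Tactic.RingSolver
  open import Data.List using (List; []; _∷_; map)
  open import Data.List.Relation.Unary.All using (All; []; _∷_; all?)
  open import Data.Product using (_,_)
  open import Data.Sum using (inj₁; inj₂)
  open import Data.Empty using (⊥-elim)
  open import Relation.Nullary using (¬_; Dec; yes; no)
  open import Relation.Binary.PropositionalEquality
    using (_≡_; _≢_; refl; sym; trans; cong; cong₂; subst; module ≡-Reasoning)
  open Coding using (encodeList; decodeList; decodeList-encodeList; encodeℤ; decodeℤ; decodeℤ-encodeℤ)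
  open Evaluation

  -- Coefficient lists, lowest degree first.
  Poly : Set
  Poly = List ℤ

  infixl 6 _+ₚ_
  infixl 7 _*ₚ_

  _+ₚ_ : Poly → Poly → Poly
  []       +ₚ q        = q
  (a ∷ p)  +ₚ []       = a ∷ p
  (a ∷ p)  +ₚ (b ∷ q)  = a + b ∷ p +ₚ q

  scale : ℤ → Poly → Poly
  scale c = map (c *_)

  -ₚ_ : Poly → Poly
  -ₚ_ = map -_

  _*ₚ_ : Poly → Poly → Poly
  []      *ₚ q = []
  (a ∷ p) *ₚ q = scale a q +ₚ (0ℤ ∷ p *ₚ q)

  ⟦_⟧ : Poly → ℤ → ℤ
  ⟦ [] ⟧    x = 0ℤ
  ⟦ a ∷ p ⟧ x = a + x * ⟦ p ⟧ x

  ⟦+ₚ⟧ : ∀ p q x → ⟦ p +ₚ q ⟧ x ≡ ⟦ p ⟧ x + ⟦ q ⟧ x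
  ⟦+ₚ⟧ []      q       x = sym (ℤ.+-identityˡ _)
  ⟦+ₚ⟧ (a ∷ p) []      x = sym (ℤ.+-identityʳ _)
  ⟦+ₚ⟧ (a ∷ p) (b ∷ q) x =
    trans (cong (λ w → a + b + x * w) (⟦+ₚ⟧ p q x)) (identity a b x (⟦ p ⟧ x) (⟦ q ⟧ x))
    where
    identity : ∀ a b x u v → (a + b) + x * (u + v) ≡ (a + x * u) + (b + x * v)
    identity = solve-∀

  ⟦scale⟧ : ∀ c p x → ⟦ scale c p ⟧ x ≡ c * ⟦ p ⟧ x
  ⟦scale⟧ c []      x = sym (ℤ.*-zeroʳ c)
  ⟦scale⟧ c (a ∷ p) x =
    trans (cong (λ w → c * a + x * w) (⟦scale⟧ c p x)) (identity c a x (⟦ p ⟧ x))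
    where
    identity : ∀ c a x u → c * a + x * (c * u) ≡ c * (a + x * u)
    identity = solve-∀

  ⟦-ₚ⟧ : ∀ p x → ⟦ -ₚ p ⟧ x ≡ - ⟦ p ⟧ x
  ⟦-ₚ⟧ []      x = refl
  ⟦-ₚ⟧ (a ∷ p) x = trans (cong (λ w → - a + x * w) (⟦-ₚ⟧ p x)) (identity a x (⟦ p ⟧ x))
    where
    identity : ∀ a x u → - a + x * (- u) ≡ - (a + x * u)
    identity = solve-∀

  ⟦*ₚ⟧ : ∀ p q x → ⟦ p *ₚ q ⟧ x ≡ ⟦ p ⟧ x * ⟦ q ⟧ x
  ⟦*ₚ⟧ []      q x = sym (ℤ.*-zeroˡ (⟦ q ⟧ x))
  ⟦*ₚ⟧ (a ∷ p) q x = begin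
    ⟦ scale a q +ₚ (0ℤ ∷ p *ₚ q) ⟧ x        ≡⟨ ⟦+ₚ⟧ (scale a q) (0ℤ ∷ p *ₚ q) x ⟩
    ⟦ scale a q ⟧ x + (0ℤ + x * ⟦ p *ₚ q ⟧ x) ≡⟨ cong₂ (λ u w → u + (0ℤ + x * w)) (⟦scale⟧ a q x) (⟦*ₚ⟧ p q x) ⟩
    a * ⟦ q ⟧ x + (0ℤ + x * (⟦ p ⟧ x * ⟦ q ⟧ x)) ≡⟨ identity a x (⟦ p ⟧ x) (⟦ q ⟧ x) ⟩
    (a + x * ⟦ p ⟧ x) * ⟦ q ⟧ x              ∎
    where
    open ≡-Reasoning
    identity : ∀ a x u v → a * v + (0ℤ + x * (u * v)) ≡ (a + x * u) * v
    identity = solve-∀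

  ⟦const⟧ : ∀ z x → ⟦ z ∷ [] ⟧ x ≡ z
  ⟦const⟧ z x = trans (cong (λ w → z + w) (ℤ.*-zeroʳ x)) (ℤ.+-identityʳ z)

  IsZeroPoly : Poly → Set
  IsZeroPoly = All (_≡ 0ℤ)

  isZeroPoly? : ∀ p → Dec (IsZeroPoly p)
  isZeroPoly? = all? (ℤ._≟ 0ℤ)

  isZeroPoly⇒⟦⟧≡0 : ∀ {p} → IsZeroPoly p → ∀ x → ⟦ p ⟧ x ≡ 0ℤ
  isZeroPoly⇒⟦⟧≡0 []           x = refl
  isZeroPoly⇒⟦⟧≡0 (refl ∷ az) x = trans (cong (λ w → 0ℤ + x * w) (isZeroPoly⇒⟦⟧≡0 az x)) (⟦const⟧ 0ℤ x)

  *-≢0 : ∀ {a b : ℤ} → a ≢ 0ℤ → b ≢ 0ℤ → a * b ≢ 0ℤ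
  *-≢0 {a} a≢0 b≢0 ab≡0 with ℤ.i*j≡0⇒i≡0∨j≡0 a ab≡0
  ... | inj₁ a≡0 = a≢0 a≡0
  ... | inj₂ b≡0 = b≢0 b≡0

  scale-¬isZero : ∀ {m} p → m ≢ 0ℤ → ¬ IsZeroPoly p → ¬ IsZeroPoly (scale m p)
  scale-¬isZero         []      m≢0 p≉0 _        = p≉0 []
  scale-¬isZero {m} (a ∷ p) m≢0 p≉0 (ma≡0 ∷ mp≡0) with ℤ.i*j≡0⇒i≡0∨j≡0 m ma≡0
  ... | inj₁ m≡0 = m≢0 m≡0
  ... | inj₂ a≡0 = scale-¬isZero p m≢0 (λ p≡0 → p≉0 (a≡0 ∷ p≡0)) mp≡0

  height : Poly → ℕ
  height []      = 0
  height (a ∷ p) = ∣ a ∣ ℕ.+ height p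

  -- If a + N·v = 0 with v ≠ 0 then N ≤ |a|.
  ⟦⟧≢0-beyond-height : ∀ p → ¬ IsZeroPoly p → ∀ N → height p < N → ⟦ p ⟧ (+ N) ≢ 0ℤ
  ⟦⟧≢0-beyond-height []      p≉0 N _ _ = p≉0 []
  ⟦⟧≢0-beyond-height (a ∷ q) p≉0 N h<N a+Nv≡0 with isZeroPoly? q
  ... | yes q≡0 = p≉0 (a≡0 ∷ q≡0)
    where
    a≡0 : a ≡ 0ℤ
    a≡0 = trans (sym (trans (cong (λ v → a + + N * v) (isZeroPoly⇒⟦⟧≡0 q≡0 (+ N))) (⟦const⟧ a (+ N)))) a+Nv≡0
  ... | no q≉0 = ℕ.<-irrefl refl (ℕ.<-≤-trans h<N (ℕ.≤-trans N≤∣a∣ (ℕ.m≤m+n ∣ a ∣ (height q))))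
    where
    v = ⟦ q ⟧ (+ N)
    v≢0 : v ≢ 0ℤ
    v≢0 = ⟦⟧≢0-beyond-height q q≉0 N (ℕ.<-≤-trans (s≤s (ℕ.m≤n+m (height q) ∣ a ∣)) h<N)
    a≡-Nv : a ≡ - (+ N * v)
    a≡-Nv = begin
      a                       ≡⟨ identity a (+ N * v) ⟩
      (a + + N * v) + - (+ N * v) ≡⟨ cong (_+ - (+ N * v)) a+Nv≡0 ⟩
      0ℤ + - (+ N * v)        ≡⟨ ℤ.+-identityˡ _ ⟩
      - (+ N * v)             ∎
      where
      open ≡-Reasoning
      identity : ∀ a b → a ≡ (a + b) + - b
      identity = solve-∀
    ∣a∣≡N*∣v∣ : ∣ a ∣ ≡ N ℕ.* ∣ v ∣
    ∣a∣≡N*∣v∣ = trans (cong ∣_∣ a≡-Nv) (trans (ℤ.∣-i∣≡∣i∣ (+ N * v)) (ℤ.∣i*j∣≡∣i∣*∣j∣ (+ N) v))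
    ∣v∣≢0 : ∣ v ∣ ≢ 0
    ∣v∣≢0 ∣v∣≡0 = v≢0 (ℤ.∣i∣≡0⇒i≡0 ∣v∣≡0)
    N≤∣a∣ : N ≤ ∣ a ∣
    N≤∣a∣ with ∣ v ∣ | ∣v∣≢0 | ∣a∣≡N*∣v∣
    ... | zero  | ∣v∣≢0′ | _  = ⊥-elim (∣v∣≢0′ refl)
    ... | suc k | _      | eq = subst (N ≤_) (sym eq) (ℕ.m≤m*n N (suc k))

  ℤ[X] : EvalDomain
  ℤ[X] = record
    { Carrier = Poly
    ; _+_ = _+ₚ_ ; _*_ = _*ₚ_ ; -_ = -ₚ_ ; 0# = [] ; 1# = 1ℤ ∷ [] ; const = _∷ []
    ; eval = λ N p → ⟦ p ⟧ (+ N)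
    ; eval-+ = λ N p q → ⟦+ₚ⟧ p q (+ N)
    ; eval-* = λ N p q → ⟦*ₚ⟧ p q (+ N)
    ; eval-- = λ N p → ⟦-ₚ⟧ p (+ N)
    ; eval-0 = λ N → refl
    ; eval-1 = λ N → ⟦const⟧ 1ℤ (+ N)
    ; eval-const = λ N z → ⟦const⟧ z (+ N)
    ; IsZero = IsZeroPoly
    ; isZero? = isZeroPoly?
    ; isZero⇒eval≡0 = λ z N → isZeroPoly⇒⟦⟧≡0 z (+ N)
    ; ¬isZero⇒eventually≢0 = λ {p} p≉0 → suc (height p) , λ N → ⟦⟧≢0-beyond-height p p≉0 N
    ; enum = decodeList ; index = encodeList ; enum-index = decodeList-encodeList
    }

  ℤ-domain : EvalDomain
  ℤ-domain = record
    { Carrier = ℤ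
    ; _+_ = _+_ ; _*_ = _*_ ; -_ = -_ ; 0# = 0ℤ ; 1# = 1ℤ ; const = λ z → z
    ; eval = λ _ z → z
    ; eval-+ = λ _ _ _ → refl ; eval-* = λ _ _ _ → refl ; eval-- = λ _ _ → refl
    ; eval-0 = λ _ → refl ; eval-1 = λ _ → refl ; eval-const = λ _ _ → refl
    ; IsZero = _≡ 0ℤ
    ; isZero? = ℤ._≟ 0ℤ
    ; isZero⇒eval≡0 = λ z _ → z
    ; ¬isZero⇒eventually≢0 = λ z≢0 → 0 , λ _ _ → z≢0
    ; enum = decodeℤ ; index = encodeℤ ; enum-index = decodeℤ-encodeℤ
    }

module Computation where

  open import Data.Nat using (ℕ; zero; suc; _<_; _≤_; _⊔_; _≟_)
  open import Data.Nat.Properties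
  open import Data.Fin using (Fin; zero; suc)
  open import Data.Vec using (Vec; []; _∷_; lookup)
  open import Data.Vec.Properties using (tabulate∘lookup; tabulate-cong)
  open import Data.Bool using (Bool)
  open import Data.Product using (_,_; proj₁; proj₂; ∃-syntax)
  open import Relation.Nullary using (yes; no)
  open import Relation.Binary.PropositionalEquality using (_≡_; refl; sym; trans; subst)
  open import Relation.Binary.Definitions using (tri<; tri≈; tri>)
  open import Defs

  lookup-injective : ∀ {m} (ys zs : Vec ℕ m) → (∀ i → lookup ys i ≡ lookup zs i) → ys ≡ zs
  lookup-injective ys zs eq = trans (sym (tabulate∘lookup ys)) (trans (tabulate-cong eq) (tabulate∘lookup zs))

  Eval-functional : ∀ {O n} {p : Prog n} {xs v w} → Eval O p xs v → Eval O p xs w → v ≡ w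
  Eval-functional evZero   evZero   = refl
  Eval-functional evSucc   evSucc   = refl
  Eval-functional evProj   evProj   = refl
  Eval-functional evOracle evOracle = refl
  Eval-functional (evComp {ys = ys} gs f) (evComp {ys = ys′} gs′ f′)
    with lookup-injective ys ys′ (λ i → Eval-functional (gs i) (gs′ i))
  ... | refl = Eval-functional f f′
  Eval-functional (evPrec0 d) (evPrec0 d′) = Eval-functional d d′
  Eval-functional (evPrecS d e) (evPrecS d′ e′) with Eval-functional d d′
  ... | refl = Eval-functional e e′
  Eval-functional (evMu {y = y} zero-at-y below) (evMu {y = y′} zero-at-y′ below′) with <-cmp y y′
  ... | tri≈ _ y≡y′ _ = y≡y′
  ... | tri< y<y′ _ _ with Eval-functional zero-at-y (proj₂ (below′ y y<y′))
  ...   | ()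
  Eval-functional (evMu {y = y} zero-at-y below) (evMu {y = y′} zero-at-y′ below′)
      | tri> _ _ y′<y with Eval-functional zero-at-y′ (proj₂ (below y′ y′<y))
  ...   | ()

  AgreeBelow : ℕ → (ℕ → Bool) → (ℕ → Bool) → Set
  AgreeBelow B O O′ = ∀ x → x < B → O x ≡ O′ x

  agreeBelow-mono : ∀ {B B′ O O′} → B ≤ B′ → AgreeBelow B′ O O′ → AgreeBelow B O O′
  agreeBelow-mono B≤B′ agree x x<B = agree x (<-≤-trans x<B B≤B′)

  maxFin : ∀ m → (Fin m → ℕ) → ℕ
  maxFin zero    f = 0
  maxFin (suc m) f = f zero ⊔ maxFin m (λ i → f (suc i))

  ≤-maxFin : ∀ m (f : Fin m → ℕ) i → f i ≤ maxFin m f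
  ≤-maxFin (suc m) f zero    = m≤m⊔n _ _
  ≤-maxFin (suc m) f (suc i) = ≤-trans (≤-maxFin m (λ j → f (suc j)) i) (m≤n⊔m (f zero) _)

  maxBelow : ∀ y → (∀ z → z < y → ℕ) → ℕ
  maxBelow zero    f = 0
  maxBelow (suc y) f = f y ≤-refl ⊔ maxBelow y (λ z z<y → f z (m<n⇒m<1+n z<y))

  ≤-maxBelow : ∀ y (f : ∀ z → z < y → ℕ) z (z<y : z < y) → f z z<y ≤ maxBelow y f
  ≤-maxBelow (suc y) f z z<1+y with z ≟ y
  ... | yes refl = subst (λ q → f z q ≤ maxBelow (suc y) f) (<-irrelevant ≤-refl z<1+y) (m≤m⊔n _ _)
  ... | no  z≢y  = subst (λ q → f z q ≤ maxBelow (suc y) f) (<-irrelevant _ z<1+y)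
        (≤-trans (≤-maxBelow y (λ z′ z′<y → f z′ (m<n⇒m<1+n z′<y)) z (≤∧≢⇒< (≤-pred z<1+y) z≢y))
                 (m≤n⊔m _ _))

  Eval-use : ∀ {O n} {p : Prog n} {xs v} → Eval O p xs v →
             ∃[ B ] (∀ O′ → AgreeBelow B O O′ → Eval O′ p xs v)
  Eval-use evZero = 0 , λ _ _ → evZero
  Eval-use evSucc = 0 , λ _ _ → evSucc
  Eval-use evProj = 0 , λ _ _ → evProj
  Eval-use (evOracle {x}) =
    suc x , λ O′ agree → subst (λ b → Eval O′ oracleP (x ∷ []) (bit b)) (sym (agree x ≤-refl)) evOracle
  Eval-use (evComp {m} gs f) = proj₁ (Eval-use f) ⊔ maxFin m uses , λ O′ agree →
    evComp (λ i → proj₂ (Eval-use (gs i)) O′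
                    (agreeBelow-mono (≤-trans (≤-maxFin m uses i) (m≤n⊔m _ _)) agree))
           (proj₂ (Eval-use f) O′ (agreeBelow-mono (m≤m⊔n _ _) agree))
    where
    uses : Fin m → ℕ
    uses i = proj₁ (Eval-use (gs i))
  Eval-use (evPrec0 d) = proj₁ (Eval-use d) , λ O′ agree → evPrec0 (proj₂ (Eval-use d) O′ agree)
  Eval-use (evPrecS d e) = proj₁ (Eval-use d) ⊔ proj₁ (Eval-use e) , λ O′ agree →
    evPrecS (proj₂ (Eval-use d) O′ (agreeBelow-mono (m≤m⊔n _ (proj₁ (Eval-use e))) agree))
            (proj₂ (Eval-use e) O′ (agreeBelow-mono (m≤n⊔m (proj₁ (Eval-use d)) _) agree))
  Eval-use (evMu {y = y} zero-at-y below) = proj₁ (Eval-use zero-at-y) ⊔ maxBelow y uses , λ O′ agree →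
    evMu (proj₂ (Eval-use zero-at-y) O′ (agreeBelow-mono (m≤m⊔n _ _) agree))
         (λ z z<y → proj₁ (below z z<y) , proj₂ (Eval-use (proj₂ (below z z<y))) O′
                      (agreeBelow-mono (≤-trans (≤-maxBelow y uses z z<y) (m≤n⊔m _ _)) agree))
    where
    uses : ∀ z → z < y → ℕ
    uses z z<y = proj₁ (Eval-use (proj₂ (below z z<y)))

module Diagram where

  open import Data.Nat using (ℕ; zero; suc; _+_; _*_; _^_; _<_; _≤_; z≤n; s≤s; _≟_)
  open import Data.Nat.Properties
  open import Data.Bool using (Bool; true)
  open import Data.List using (List; _++_; applyUpTo; cartesianProductWith)
  open import Data.List.Membership.Propositional using (_∈_; find; lose)
  open import Data.List.Membership.Propositional.Properties
    using (∈-++⁺ˡ; ∈-++⁺ʳ; ∈-++⁻; ∈-applyUpTo⁺; ∈-applyUpTo⁻; ∈-cartesianProductWith⁺; ∈-cartesianProductWith⁻)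
  open import Data.List.Relation.Unary.Any using (Any; any?)
  open import Data.Product using (_×_; _,_; proj₁; proj₂; ∃-syntax)
  open import Data.Sum using (inj₁; inj₂)
  open import Data.Empty using (⊥; ⊥-elim)
  open import Relation.Nullary using (Dec; yes; does)
  open import Relation.Nullary.Decidable using (_×-dec_; dec-true; does-⇔)
  open import Relation.Binary.PropositionalEquality using (_≡_; refl; sym; trans; cong; cong₂; subst)
  open import Function.Bundles using (mk⇔)
  open import Defs

  n<2^n : ∀ n → n < 2 ^ n
  n<2^n zero    = s≤s z≤n
  n<2^n (suc n) = subst (suc (suc n) ≤_) (cong (2 ^ n +_) (sym (+-identityʳ (2 ^ n))))
    (subst (_≤ 2 ^ n + 2 ^ n) (+-comm (suc n) 1) (+-mono-≤ (n<2^n n) (m^n>0 2 n)))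

  m<pair : ∀ a b → a < pair a b
  m<pair a b = <-≤-trans (n<2^n a) (m≤m*n (2 ^ a) (suc (2 * b)))

  n<pair : ∀ a b → b < pair a b
  n<pair a b = <-≤-trans (s≤s (m≤m+n b (b + 0))) (m≤n*m (suc (2 * b)) (2 ^ a) {{m^n≢0 2 a}})

  pair-zero : ∀ b → pair 0 b ≡ suc (2 * b)
  pair-zero b = *-identityˡ (suc (2 * b))

  pair-suc : ∀ a b → pair (suc a) b ≡ 2 * pair a b
  pair-suc a b = *-assoc 2 (2 ^ a) (suc (2 * b))

  pair-injective : ∀ a b a′ b′ → pair a b ≡ pair a′ b′ → a ≡ a′ × b ≡ b′
  pair-injective zero b zero b′ eq =
    refl , *-cancelˡ-≡ b b′ 2 (suc-injective (trans (sym (pair-zero b)) (trans eq (pair-zero b′))))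
  pair-injective zero b (suc a′) b′ eq =
    ⊥-elim (even≢odd (pair a′ b′) b (trans (sym (pair-suc a′ b′)) (trans (sym eq) (pair-zero b))))
  pair-injective (suc a) b zero b′ eq =
    ⊥-elim (even≢odd (pair a b) b′ (trans (sym (pair-suc a b)) (trans eq (pair-zero b′))))
  pair-injective (suc a) b (suc a′) b′ eq
    with pair-injective a b a′ b′ (*-cancelˡ-≡ _ _ 2 (trans (sym (pair-suc a b)) (trans eq (pair-suc a′ b′))))
  ... | refl , refl = refl , refl

  tag : Term → ℕ
  tag (con _)     = 0
  tag (plus _ _)  = 1
  tag (times _ _) = 2

  payload : Term → ℕ
  payload (con n)     = n
  payload (plus s t)  = pair (codeTerm s) (codeTerm t)
  payload (times s t) = pair (codeTerm s) (codeTerm t)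

  codeTerm-tag-payload : ∀ t → codeTerm t ≡ pair (tag t) (payload t)
  codeTerm-tag-payload (con _)     = refl
  codeTerm-tag-payload (plus _ _)  = refl
  codeTerm-tag-payload (times _ _) = refl

  codeTerm-injective : ∀ s t → codeTerm s ≡ codeTerm t → s ≡ t
  codeTerm-injective s t eq = by-parts s t (pair-injective (tag s) (payload s) (tag t) (payload t)
    (trans (sym (codeTerm-tag-payload s)) (trans eq (codeTerm-tag-payload t))))
    where
    by-parts : ∀ s t → tag s ≡ tag t × payload s ≡ payload t → s ≡ t
    by-parts (con _) (con _) (_ , eq) = cong con eq
    by-parts (plus s t) (plus s′ t′) (_ , eq) with pair-injective _ _ _ _ eq
    ... | s≡ , t≡ = cong₂ plus (codeTerm-injective s s′ s≡) (codeTerm-injective t t′ t≡)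
    by-parts (times s t) (times s′ t′) (_ , eq) with pair-injective _ _ _ _ eq
    ... | s≡ , t≡ = cong₂ times (codeTerm-injective s s′ s≡) (codeTerm-injective t t′ t≡)
    by-parts (con _)     (plus _ _)  (() , _)
    by-parts (con _)     (times _ _) (() , _)
    by-parts (plus _ _)  (con _)     (() , _)
    by-parts (plus _ _)  (times _ _) (() , _)
    by-parts (times _ _) (con _)     (() , _)
    by-parts (times _ _) (plus _ _)  (() , _)

  codeAtom-injective : ∀ s t s′ t′ → codeAtom (eqA s t) ≡ codeAtom (eqA s′ t′) → s ≡ s′ × t ≡ t′
  codeAtom-injective s t s′ t′ eq
    with pair-injective _ _ _ _ (proj₂ (pair-injective 0 _ 0 _ eq))
  ... | s≡ , t≡ = codeTerm-injective s s′ s≡ , codeTerm-injective t t′ t≡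

  Bounded : Term → ℕ → ℕ → Set
  Bounded (con n)     _       c = n < c
  Bounded (plus s t)  zero    _ = ⊥
  Bounded (plus s t)  (suc d) c = Bounded s d c × Bounded t d c
  Bounded (times s t) zero    _ = ⊥
  Bounded (times s t) (suc d) c = Bounded s d c × Bounded t d c

  Bounded-mono : ∀ t {d c d′ c′} → d ≤ d′ → c ≤ c′ → Bounded t d c → Bounded t d′ c′
  Bounded-mono (con n) _ c≤c′ n<c = <-≤-trans n<c c≤c′
  Bounded-mono (plus s t)  {suc d} {d′ = suc d′} (s≤s d≤d′) c≤c′ (bs , bt) =
    Bounded-mono s d≤d′ c≤c′ bs , Bounded-mono t d≤d′ c≤c′ bt
  Bounded-mono (times s t) {suc d} {d′ = suc d′} (s≤s d≤d′) c≤c′ (bs , bt) =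
    Bounded-mono s d≤d′ c≤c′ bs , Bounded-mono t d≤d′ c≤c′ bt

  subterm-codes : ∀ k s t → codeTerm s < pair k (pair (codeTerm s) (codeTerm t))
                          × codeTerm t < pair k (pair (codeTerm s) (codeTerm t))
  subterm-codes k s t =
    <-trans (m<pair (codeTerm s) (codeTerm t)) (n<pair k _) , <-trans (n<pair (codeTerm s) (codeTerm t)) (n<pair k _)

  Bounded-plus⁻ : ∀ s t {d c} → Bounded (plus s t) d c → Bounded s d c × Bounded t d c
  Bounded-plus⁻ s t {suc d} (bs , bt) = Bounded-mono s (n≤1+n d) ≤-refl bs , Bounded-mono t (n≤1+n d) ≤-refl bt

  Bounded-times⁻ : ∀ s t {d c} → Bounded (times s t) d c → Bounded s d c × Bounded t d c
  Bounded-times⁻ s t {suc d} (bs , bt) = Bounded-mono s (n≤1+n d) ≤-refl bs , Bounded-mono t (n≤1+n d) ≤-refl bt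

  Bounded-codeTerm : ∀ t {d c} → codeTerm t < d → codeTerm t < c → Bounded t d c
  Bounded-subterms : ∀ k s t {d c} → pair k (pair (codeTerm s) (codeTerm t)) ≤ d →
                     pair k (pair (codeTerm s) (codeTerm t)) < c → Bounded s d c × Bounded t d c

  Bounded-codeTerm (con n)     _            n<c    = <-trans (n<pair 0 n) n<c
  Bounded-codeTerm (plus s t)  {suc d} (s≤s code≤d) code<c = Bounded-subterms 1 s t code≤d code<c
  Bounded-codeTerm (times s t) {suc d} (s≤s code≤d) code<c = Bounded-subterms 2 s t code≤d code<c

  Bounded-subterms k s t code≤d code<c with subterm-codes k s t
  ... | s< , t< = Bounded-codeTerm s (<-≤-trans s< code≤d) (<-trans s< code<c)
                , Bounded-codeTerm t (<-≤-trans t< code≤d) (<-trans t< code<c)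

  terms : ℕ → ℕ → List Term
  terms zero    c = applyUpTo con c
  terms (suc d) c = applyUpTo con c ++ cartesianProductWith plus  (terms d c) (terms d c)
                                    ++ cartesianProductWith times (terms d c) (terms d c)

  ∈-terms⁺ : ∀ t {d c} → Bounded t d c → t ∈ terms d c
  ∈-terms⁺ (con n) {zero}  n<c = ∈-applyUpTo⁺ con n<c
  ∈-terms⁺ (con n) {suc d} n<c = ∈-++⁺ˡ (∈-applyUpTo⁺ con n<c)
  ∈-terms⁺ (plus s t)  {suc d} {c} (bs , bt) = ∈-++⁺ʳ (applyUpTo con c)
    (∈-++⁺ˡ (∈-cartesianProductWith⁺ plus (∈-terms⁺ s bs) (∈-terms⁺ t bt)))
  ∈-terms⁺ (times s t) {suc d} {c} (bs , bt) = ∈-++⁺ʳ (applyUpTo con c)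
    (∈-++⁺ʳ (cartesianProductWith plus (terms d c) (terms d c))
      (∈-cartesianProductWith⁺ times (∈-terms⁺ s bs) (∈-terms⁺ t bt)))

  ∈-terms⁻ : ∀ t d c → t ∈ terms d c → Bounded t d c
  ∈-terms⁻ t zero c t∈ with ∈-applyUpTo⁻ con t∈
  ... | n , n<c , refl = n<c
  ∈-terms⁻ t (suc d) c t∈ with ∈-++⁻ (applyUpTo con c) t∈
  ... | inj₁ t∈cs with ∈-applyUpTo⁻ con t∈cs
  ...   | n , n<c , refl = n<c
  ∈-terms⁻ t (suc d) c t∈ | inj₂ t∈ps with ∈-++⁻ (cartesianProductWith plus (terms d c) (terms d c)) t∈ps
  ... | inj₁ t∈+ with ∈-cartesianProductWith⁻ plus (terms d c) (terms d c) t∈+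
  ...   | a , b , a∈ , b∈ , refl = ∈-terms⁻ a d c a∈ , ∈-terms⁻ b d c b∈
  ∈-terms⁻ t (suc d) c t∈ | inj₂ t∈ps | inj₂ t∈* with ∈-cartesianProductWith⁻ times (terms d c) (terms d c) t∈*
  ... | a , b , a∈ , b∈ , refl = ∈-terms⁻ a d c a∈ , ∈-terms⁻ b d c b∈

  -- Every atom with code x is an equation between terms in terms x x, so the diagram is decided
  -- by a finite search.
  Witness : FieldOnℕ → ℕ → Set
  Witness K x = Any (λ s → Any (λ t → codeAtom (eqA s t) ≡ x × Sat K (eqA s t)) (terms x x)) (terms x x)

  witness? : ∀ K x → Dec (Witness K x)
  witness? K x = any? (λ s → any? (λ t →
    (codeAtom (eqA s t) ≟ x) ×-dec (evalTerm K s ≟ evalTerm K t)) (terms x x)) (terms x x)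

  diagram : FieldOnℕ → ℕ → Bool
  diagram K x = does (witness? K x)

  does-true : ∀ {P : Set} (p? : Dec P) → does p? ≡ true → P
  does-true (yes p) _ = p

  Witness⇒ : ∀ {K x} → Witness K x → ∃[ s ] ∃[ t ] (codeAtom (eqA s t) ≡ x × Sat K (eqA s t))
  Witness⇒ w with find w
  ... | s , _ , w′ with find w′
  ...   | t , _ , code≡x , sat = s , t , code≡x , sat

  terms-codeAtom : ∀ s t → s ∈ terms (codeAtom (eqA s t)) (codeAtom (eqA s t))
                         × t ∈ terms (codeAtom (eqA s t)) (codeAtom (eqA s t))
  terms-codeAtom s t with subterm-codes 0 s t
  ... | s< , t< = ∈-terms⁺ s (Bounded-codeTerm s s< s<) , ∈-terms⁺ t (Bounded-codeTerm t t< t<)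

  diagram-isDiagram : ∀ K → IsDiagramOf codeAtom (Sat K) (diagram K)
  diagram-isDiagram K = (λ { (eqA s t) → mk⇔ (to s t) (from s t) }) , codes
    where
    to : ∀ s t → diagram K (codeAtom (eqA s t)) ≡ true → Sat K (eqA s t)
    to s t d≡true with Witness⇒ (does-true (witness? K _) d≡true)
    ... | s′ , t′ , code≡ , sat with codeAtom-injective s′ t′ s t code≡
    ...   | refl , refl = sat
    from : ∀ s t → Sat K (eqA s t) → diagram K (codeAtom (eqA s t)) ≡ true
    from s t sat = dec-true (witness? K _)
      (lose (proj₁ (terms-codeAtom s t)) (lose (proj₂ (terms-codeAtom s t)) (refl , sat)))
    codes : ∀ x → diagram K x ≡ true → ∃[ φ ] (codeAtom φ ≡ x)
    codes x d≡true with Witness⇒ (does-true (witness? K x) d≡true)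
    ... | s , t , code≡x , _ = eqA s t , code≡x

  Witness-local : ∀ K K′ x → (∀ t → t ∈ terms x x → evalTerm K t ≡ evalTerm K′ t) →
                  Witness K x → Witness K′ x
  Witness-local K K′ x agree w with find w
  ... | s , s∈ , w′ with find w′
  ...   | t , t∈ , code≡x , sat =
    lose s∈ (lose t∈ (code≡x , trans (sym (agree s s∈)) (trans sat (agree t t∈))))

  diagram-local : ∀ K K′ x → (∀ t → t ∈ terms x x → evalTerm K t ≡ evalTerm K′ t) →
                  diagram K x ≡ diagram K′ x
  diagram-local K K′ x agree = does-⇔
    (mk⇔ (Witness-local K K′ x agree) (Witness-local K′ K x λ t t∈ → sym (agree t t∈)))
    (witness? K x) (witness? K′ x)

module Transcendence where

  open import Level using (0ℓ)
  open import Data.Nat using (ℕ; zero; suc)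
  open import Data.List using (List; []; _∷_; map)
  open import Data.List.Relation.Unary.All using (All; []; _∷_)
  open import Data.List.Relation.Unary.Any using (Any; here; there)
  open import Data.Vec using ([]; _∷_)
  open import Data.Product using (_,_; proj₁; proj₂)
  open import Relation.Binary.PropositionalEquality
    using (_≡_; _≢_; refl; sym; trans; cong; cong₂; subst; module ≡-Reasoning)
  open import Algebra.Bundles using (CommutativeRing)
  import Algebra.Properties.Group as GroupProperties
  open import Function.Bundles using (_⇔_; mk⇔)
  open import Defs

  commutativeRing : FieldOnℕ → CommutativeRing 0ℓ 0ℓ
  commutativeRing K = record { isCommutativeRing = FieldOnℕ.isCommutativeRing K }

  module FieldProperties (K : FieldOnℕ) where

    open FieldOnℕ K
    open CommutativeRing (commutativeRing K) using (*-identityʳ; *-assoc)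
    open GroupProperties (CommutativeRing.+-group (commutativeRing K)) public
      using (identityˡ-unique; inverseˡ-unique)

    idempotent≢0⇒≡1 : ∀ y → y ≢ 0# → y * y ≡ y → y ≡ 1#
    idempotent≢0⇒≡1 y y≢0 yy≡y with inverse y y≢0
    ... | z , yz≡1 = begin
      y           ≡⟨ *-identityʳ y ⟨
      y * 1#      ≡⟨ cong (y *_) yz≡1 ⟨
      y * (y * z) ≡⟨ *-assoc y y z ⟨
      (y * y) * z ≡⟨ cong (_* z) yy≡y ⟩
      y * z       ≡⟨ yz≡1 ⟩
      1#          ∎
      where open ≡-Reasoning

  module Monomorphism (A B : FieldOnℕ) (φ : ℕ → ℕ)
    (φ-injective : ∀ {x y} → φ x ≡ φ y → x ≡ y)
    (φ-+ : ∀ x y → φ (FieldOnℕ._+_ A x y) ≡ FieldOnℕ._+_ B (φ x) (φ y))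
    (φ-* : ∀ x y → φ (FieldOnℕ._*_ A x y) ≡ FieldOnℕ._*_ B (φ x) (φ y)) where

    module A = FieldOnℕ A
    module B = FieldOnℕ B
    module PA = CommutativeRing (commutativeRing A)
    module PB = FieldProperties B

    φ-0 : φ A.0# ≡ B.0#
    φ-0 = PB.identityˡ-unique _ _ (trans (sym (φ-+ A.0# A.0#)) (cong φ (PA.+-identityˡ A.0#)))

    φ-≢0 : ∀ {x} → x ≢ A.0# → φ x ≢ B.0#
    φ-≢0 x≢0 φx≡0 = x≢0 (φ-injective (trans φx≡0 (sym φ-0)))

    φ-1 : φ A.1# ≡ B.1#
    φ-1 = PB.idempotent≢0⇒≡1 _ (φ-≢0 λ 1≡0 → A.0≢1 (sym 1≡0))
            (trans (sym (φ-* A.1# A.1#)) (cong φ (PA.*-identityˡ A.1#)))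

    φ-- : ∀ x → φ (A.- x) ≡ B.- (φ x)
    φ-- x = PB.inverseˡ-unique _ _ (trans (sym (φ-+ (A.- x) x)) (trans (cong φ (PA.-‿inverseˡ x)) φ-0))

    φ-ι : ∀ n → φ (A.ι n) ≡ B.ι n
    φ-ι zero    = φ-0
    φ-ι (suc n) = trans (φ-+ A.1# (A.ι n)) (cong₂ B._+_ φ-1 (φ-ι n))

    φ-InPrime : ∀ {x} → A.InPrime x → B.InPrime (φ x)
    φ-InPrime {x} (a , b , c , ιc≢0 , eq) = a , b , c , ιc≢0′ , (begin
      φ x B.* B.ι c                   ≡⟨ cong (φ x B.*_) (φ-ι c) ⟨
      φ x B.* φ (A.ι c)               ≡⟨ φ-* x (A.ι c) ⟨
      φ (x A.* A.ι c)                 ≡⟨ cong φ eq ⟩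
      φ (A.ι a A.+ (A.- A.ι b))       ≡⟨ φ-+ _ _ ⟩
      φ (A.ι a) B.+ φ (A.- A.ι b)     ≡⟨ cong₂ B._+_ (φ-ι a) (trans (φ-- (A.ι b)) (cong B.-_ (φ-ι b))) ⟩
      B.ι a B.+ (B.- B.ι b)           ∎)
      where
      open ≡-Reasoning
      ιc≢0′ : B.ι c ≢ B.0#
      ιc≢0′ = subst (_≢ B.0#) (φ-ι c) (φ-≢0 ιc≢0)

    φ-evalPoly : ∀ (f : List ℕ) x → B.evalPoly 1 (map φ f) (φ x ∷ []) ≡ φ (A.evalPoly 1 f (x ∷ []))
    φ-evalPoly []       x = sym φ-0
    φ-evalPoly (c ∷ cs) x = begin
      φ c B.+ (φ x B.* B.evalPoly 1 (map φ cs) (φ x ∷ []))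
        ≡⟨ cong (λ u → φ c B.+ (φ x B.* u)) (φ-evalPoly cs x) ⟩
      φ c B.+ (φ x B.* φ (A.evalPoly 1 cs (x ∷ [])))       ≡⟨ cong (φ c B.+_) (φ-* x _) ⟨
      φ c B.+ φ (x A.* A.evalPoly 1 cs (x ∷ []))           ≡⟨ φ-+ c _ ⟨
      φ (c A.+ (x A.* A.evalPoly 1 cs (x ∷ [])))           ∎
      where open ≡-Reasoning

    All-InPrime : ∀ {f} → All A.InPrime f → All B.InPrime (map φ f)
    All-InPrime []       = []
    All-InPrime (p ∷ ps) = φ-InPrime p ∷ All-InPrime ps

    Any-≢0 : ∀ {f} → Any (_≢ A.0#) f → Any (_≢ B.0#) (map φ f)
    Any-≢0 (here c≢0) = here (φ-≢0 c≢0)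
    Any-≢0 (there cs) = there (Any-≢0 cs)

    -- A polynomial relation for x over the prime field is carried by φ to one for φ x.
    Transc-reflect : ∀ n → B.Transc (φ n) → A.Transc n
    Transc-reflect n transc f prime nonzero fn≡0 =
      transc (map φ f) (All-InPrime prime) (Any-≢0 nonzero) (trans (φ-evalPoly f n) (trans (cong φ fn≡0) φ-0))

  module Inverse (L K : FieldOnℕ) (iso : L ≅ K) where

    h = proj₁ iso
    h-injective = proj₁ (proj₁ (proj₂ iso))
    h-surjective = proj₂ (proj₁ (proj₂ iso))
    h-+ = proj₁ (proj₂ (proj₂ iso))
    h-* = proj₂ (proj₂ (proj₂ iso))

    h⁻¹ : ℕ → ℕ
    h⁻¹ y = proj₁ (h-surjective y)

    h-h⁻¹ : ∀ y → h (h⁻¹ y) ≡ y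
    h-h⁻¹ y = proj₂ (h-surjective y) refl

    h⁻¹-h : ∀ x → h⁻¹ (h x) ≡ x
    h⁻¹-h x = h-injective (h-h⁻¹ (h x))

    h⁻¹-injective : ∀ {x y} → h⁻¹ x ≡ h⁻¹ y → x ≡ y
    h⁻¹-injective {x} {y} eq = trans (sym (h-h⁻¹ x)) (trans (cong h eq) (h-h⁻¹ y))

    h⁻¹-+ : ∀ x y → h⁻¹ (FieldOnℕ._+_ K x y) ≡ FieldOnℕ._+_ L (h⁻¹ x) (h⁻¹ y)
    h⁻¹-+ x y = h-injective (trans (h-h⁻¹ _)
      (trans (cong₂ (FieldOnℕ._+_ K) (sym (h-h⁻¹ x)) (sym (h-h⁻¹ y))) (sym (h-+ (h⁻¹ x) (h⁻¹ y)))))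

    h⁻¹-* : ∀ x y → h⁻¹ (FieldOnℕ._*_ K x y) ≡ FieldOnℕ._*_ L (h⁻¹ x) (h⁻¹ y)
    h⁻¹-* x y = h-injective (trans (h-h⁻¹ _)
      (trans (cong₂ (FieldOnℕ._*_ K) (sym (h-h⁻¹ x)) (sym (h-h⁻¹ y))) (sym (h-* (h⁻¹ x) (h⁻¹ y)))))

  Transc-≅ : ∀ L K (iso : L ≅ K) n → FieldOnℕ.Transc L n ⇔ FieldOnℕ.Transc K (proj₁ iso n)
  Transc-≅ L K iso n = mk⇔
    (λ transc → Monomorphism.Transc-reflect K L h⁻¹ h⁻¹-injective h⁻¹-+ h⁻¹-* (h n)
                  (subst (FieldOnℕ.Transc L) (sym (h⁻¹-h n)) transc))
    (Monomorphism.Transc-reflect L K h h-injective h-+ h-* n)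
    where open Inverse L K iso

module RationalFunctions where

  open import Data.Nat using (ℕ)
  open import Data.Integer using (ℤ; +_; _+_; _*_; 0ℤ; 1ℤ)
  import Data.Integer.Properties as ℤ
  open import Data.Integer.Tactic.RingSolver
  open import Data.List using (List; []; _∷_)
  open import Data.List.Relation.Unary.All using (All; []; _∷_)
  open import Data.List.Relation.Unary.Any using (Any; here; there)
  open import Data.Vec using ([]; _∷_)
  open import Data.Product using (_,_)
  open import Relation.Nullary using (¬_)
  open import Relation.Binary.PropositionalEquality as ≡ using (_≡_; _≢_; refl; cong; cong₂)
  open import Defs using (FieldOnℕ)
  open Polynomial
  open Fraction ℤ[X] renaming (fraction to _/_∣_)
  open Elements enum index enum-index public

  ℚ⟨X⟩ : FieldOnℕ
  ℚ⟨X⟩ = fieldOnℕ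

  open FieldOnℕ ℚ⟨X⟩ using (InPrime; Transc; evalPoly; 0#)

  X : Fraction
  X = (0ℤ ∷ 1ℤ ∷ []) / (1ℤ ∷ []) ∣ 1ᴰ≉0

  x : ℕ
  x = position X

  numAt-X : ∀ N → numAt N X ≡ + N
  numAt-X N = identity (+ N)
    where
    identity : ∀ y → 0ℤ + y * (1ℤ + y * 0ℤ) ≡ y
    identity = solve-∀

  evalAt-x : List ℕ → ℕ
  evalAt-x f = evalPoly 1 f (x ∷ [])

  record ClearedDenominator (f : List ℕ) : Set where
    field
      P       : Poly
      d       : ℤ
      d≢0     : d ≢ 0ℤ
      value   : element (evalAt-x f) ≈ P / (d ∷ []) ∣ const≉0 d≢0
      nonzero : Any (_≢ 0#) f → ¬ IsZeroPoly P

  ⊕-X⊗ : ∀ α m P d (m≢0 : m ≢ 0ℤ) (d≢0 : d ≢ 0ℤ) →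
    ratio α m m≢0 ⊕ X ⊗ (P / (d ∷ []) ∣ const≉0 d≢0)
      ≈ (α * d ∷ scale m P) / (m * d ∷ []) ∣ const≉0 (*-≢0 m≢0 d≢0)
  ⊕-X⊗ α m P d m≢0 d≢0 = Cross⇒≈ λ N → cross-by
    (≡.trans (numAt-⊕ N A XR) (cong₂ _+_
      (cong₂ _*_ (⟦const⟧ α (+ N)) (denAt-XR N))
      (cong₂ _*_ (≡.trans (numAt-⊗ N X R) (cong (_* ⟦ P ⟧ (+ N)) (numAt-X N))) (⟦const⟧ m (+ N)))))
    (⟦const⟧ (m * d) (+ N))
    (cong (λ u → α * d + + N * u) (⟦scale⟧ m P (+ N)))
    (≡.trans (denAt-⊕ N A XR) (cong₂ _*_ (⟦const⟧ m (+ N)) (denAt-XR N)))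
    (identity α d m (+ N) (⟦ P ⟧ (+ N)))
    where
    A = ratio α m m≢0
    R = P / (d ∷ []) ∣ const≉0 d≢0
    XR = X ⊗ R
    denAt-XR : ∀ N → denAt N XR ≡ 1ℤ * d
    denAt-XR N = ≡.trans (denAt-⊗ N X R) (cong₂ _*_ (⟦const⟧ 1ℤ (+ N)) (⟦const⟧ d (+ N)))
    identity : ∀ α d m y p → (α * (1ℤ * d) + (y * p) * m) * (m * d)
                           ≡ (α * d + y * (m * p)) * (m * (1ℤ * d))
    identity = solve-∀

  clearDenominator : ∀ f → All InPrime f → ClearedDenominator f
  clearDenominator []       []         = record
    { P = [] ; d = 1ℤ ; d≢0 = λ () ; value = 0#-homo ; nonzero = λ () }
  clearDenominator (c ∷ cs) (c∈ℚ ∷ cs∈ℚ) with element-InPrime c∈ℚ | clearDenominator cs cs∈ℚ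
  ... | α , m , m≢0 , c≈α/m
      | record { P = P ; d = d ; d≢0 = d≢0 ; value = value ; nonzero = nonzero } = record
    { P = α * d ∷ scale m P
    ; d = m * d
    ; d≢0 = *-≢0 m≢0 d≢0
    ; value = +-homo c _ ∙ ⊕-cong c≈α/m (*-homo x _ ∙ ⊗-cong (element-position X) value)
            ∙ ⊕-X⊗ α m P d m≢0 d≢0
    ; nonzero = λ
      { (here c≢0)    (αd≡0 ∷ _) → *-≢0 (α≢0 c≢0) d≢0 αd≡0
      ; (there cs≢0) (_ ∷ mP≡0) → scale-¬isZero P m≢0 (nonzero cs≢0) mP≡0 }
    }
    where
    α≢0 : c ≢ 0# → α ≢ 0ℤ
    α≢0 c≢0 refl = c≢0 (element-injective (c≈α/m ∙ isZero-num⇒≈𝟎 _ (refl ∷ []) ∙ ≈-sym 0#-homo))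

  x-transcendental : Transc x
  x-transcendental f prime f≢0 fx≡0 = nonzero f≢0 (≈𝟎⇒isZero-num (P / (d ∷ []) ∣ const≉0 d≢0) P/d≈𝟎)
    where
    open ClearedDenominator (clearDenominator f prime)
    P/d≈𝟎 : P / (d ∷ []) ∣ const≉0 d≢0 ≈ 𝟎
    P/d≈𝟎 = ≈-sym value ∙ ≈-reflexive (cong element fx≡0) ∙ 0#-homo

module Rationals where

  open import Data.Nat using (ℕ)
  open import Data.Integer using (_+_; _*_; -_; 0ℤ; 1ℤ)
  open import Data.Integer.Tactic.RingSolver
  open import Data.List using ([]; _∷_)
  open import Data.List.Relation.Unary.All using ([]; _∷_)
  open import Data.List.Relation.Unary.Any using (here; there)
  open import Data.Vec using ([]; _∷_)
  open import Relation.Nullary using (¬_)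
  open import Relation.Binary.PropositionalEquality using (_≡_)
  open import Defs using (FieldOnℕ)
  open Polynomial using (ℤ-domain)
  open Fraction ℤ-domain

  module Algebraic (e : ℕ → Fraction) (i : Fraction → ℕ) (e-i : ∀ x → e (i x) ≈ x) where

    open Elements e i e-i
    open FieldOnℕ fieldOnℕ using (Transc) renaming (0# to 0#ᴷ)

    -- y = a/b is a root of b·Y − a.
    no-transcendental : ∀ y → ¬ Transc y
    no-transcendental y transc = transc f (InPrime-position-fromℤ (- a) ∷ InPrime-position-fromℤ b ∷ [])
                                         (there (here b≢0)) (element-injective (root ∙ ≈-sym 0#-homo))
      where
      a = num (element y)
      b = den (element y)
      c₀ = position (fromℤ (- a))
      c₁ = position (fromℤ b)
      f = c₀ ∷ c₁ ∷ []
      b≢0 = element≢0 λ b≈𝟎 → den≉0 (element y)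
              (fromℤ-injective (≈-sym (element-position (fromℤ b)) ∙ b≈𝟎 ∙ fromℤ-0))
      identity : ∀ a b → ((- a) * (b * (1ℤ * (b * 1ℤ))) + (a * (b * (b * 1ℤ) + (a * 0ℤ) * 1ℤ)) * 1ℤ) * 1ℤ
                       ≡ 0ℤ * (1ℤ * (b * (1ℤ * (b * 1ℤ))))
      identity = solve-∀
      root : element (FieldOnℕ.evalPoly fieldOnℕ 1 f (y ∷ [])) ≈ 𝟎
      root = +-homo c₀ _ ∙ ⊕-cong (element-position (fromℤ (- a)))
               (*-homo y _ ∙ ⊗-cong (≈-refl {element y})
                 (+-homo c₁ _ ∙ ⊕-cong (element-position (fromℤ b))
                   (*-homo y 0#ᴷ ∙ ⊗-cong (≈-refl {element y}) 0#-homo)))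
           ∙ Cross⇒≈ λ _ → identity a b

module Approximation where

  open import Data.Nat as ℕ using (ℕ; zero; suc; _<_; s≤s; _≟_)
  import Data.Nat.Properties as ℕ
  open import Data.Integer using (ℤ; _+_; _*_; 0ℤ)
  import Data.Integer.Properties as ℤ
  open import Data.List using (List; map)
  open import Data.List.Membership.Propositional.Properties using (∈-map⁺)
  import Data.List.Relation.Unary.All as All
  open import Data.List.Extrema.Nat using (max; xs≤max)
  open import Data.Product using (_×_; _,_; proj₁; proj₂; ∃-syntax)
  open import Data.Empty using (⊥-elim)
  open import Relation.Nullary using (¬_; yes; no)
  open import Relation.Binary.PropositionalEquality using (_≡_; _≢_; refl; sym; trans; cong₂; subst; subst₂)
  open import Defs
  open Eventually
  open Countable using (prefixed; prefixed-<; prefixed-+)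
  open Computation using (AgreeBelow)
  open Diagram
  open Polynomial
  module ℚX = Fraction ℤ[X]
  module ℚ = Fraction ℤ-domain
  open RationalFunctions using (ℚ⟨X⟩) renaming (element to elementX)
  open Rationals

  -- The specialisation X ↦ N; it is junk (zero) where the denominator vanishes at N.
  specialise : ℕ → ℚX.Fraction → ℚ.Fraction
  specialise N x with ℚX.denAt N x ℤ.≟ 0ℤ
  ... | yes _   = ℚ.𝟎
  ... | no  d≢0 = ℚ.fraction (ℚX.numAt N x) (ℚX.denAt N x) d≢0

  module _ (N : ℕ) where

    open ℚX using (numAt; denAt)

    specialise-parts : ∀ x → denAt N x ≢ 0ℤ →
                       ℚ.num (specialise N x) ≡ numAt N x × ℚ.den (specialise N x) ≡ denAt N x
    specialise-parts x d≢0 with ℚX.denAt N x ℤ.≟ 0ℤ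
    ... | yes d≡0 = ⊥-elim (d≢0 d≡0)
    ... | no  _   = refl , refl

    specialise-num : ∀ x → denAt N x ≢ 0ℤ → ℚ.num (specialise N x) ≡ numAt N x
    specialise-num x d≢0 = proj₁ (specialise-parts x d≢0)

    specialise-den : ∀ x → denAt N x ≢ 0ℤ → ℚ.den (specialise N x) ≡ denAt N x
    specialise-den x d≢0 = proj₂ (specialise-parts x d≢0)

    denAt-⊕-≢0 : ∀ x y → denAt N x ≢ 0ℤ → denAt N y ≢ 0ℤ → denAt N (x ℚX.⊕ y) ≢ 0ℤ
    denAt-⊕-≢0 x y x≢0 y≢0 eq = *-≢0 x≢0 y≢0 (trans (sym (ℚX.denAt-⊕ N x y)) eq)

    denAt-⊗-≢0 : ∀ x y → denAt N x ≢ 0ℤ → denAt N y ≢ 0ℤ → denAt N (x ℚX.⊗ y) ≢ 0ℤ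
    denAt-⊗-≢0 x y x≢0 y≢0 eq = *-≢0 x≢0 y≢0 (trans (sym (ℚX.denAt-⊗ N x y)) eq)

    specialise-⊕ : ∀ x y → denAt N x ≢ 0ℤ → denAt N y ≢ 0ℤ →
                   specialise N (x ℚX.⊕ y) ℚ.≈ specialise N x ℚ.⊕ specialise N y
    specialise-⊕ x y x≢0 y≢0 = ℚ.Cross⇒≈ λ _ → ℚ.cross-by
      (trans (specialise-num (x ℚX.⊕ y) xy≢0) (ℚX.numAt-⊕ N x y))
      (cong₂ _*_ (specialise-den x x≢0) (specialise-den y y≢0))
      (cong₂ _+_ (cong₂ _*_ (specialise-num x x≢0) (specialise-den y y≢0))
                 (cong₂ _*_ (specialise-num y y≢0) (specialise-den x x≢0)))
      (trans (specialise-den (x ℚX.⊕ y) xy≢0) (ℚX.denAt-⊕ N x y))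
      refl
      where xy≢0 = denAt-⊕-≢0 x y x≢0 y≢0

    specialise-⊗ : ∀ x y → denAt N x ≢ 0ℤ → denAt N y ≢ 0ℤ →
                   specialise N (x ℚX.⊗ y) ℚ.≈ specialise N x ℚ.⊗ specialise N y
    specialise-⊗ x y x≢0 y≢0 = ℚ.Cross⇒≈ λ _ → ℚ.cross-by
      (trans (specialise-num (x ℚX.⊗ y) xy≢0) (ℚX.numAt-⊗ N x y))
      (cong₂ _*_ (specialise-den x x≢0) (specialise-den y y≢0))
      (cong₂ _*_ (specialise-num x x≢0) (specialise-num y y≢0))
      (trans (specialise-den (x ℚX.⊗ y) xy≢0) (ℚX.denAt-⊗ N x y))
      refl
      where xy≢0 = denAt-⊗-≢0 x y x≢0 y≢0

    specialise-cong : ∀ {x y} → x ℚX.≈ y → denAt N x ≢ 0ℤ → denAt N y ≢ 0ℤ →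
                      specialise N x ℚ.≈ specialise N y
    specialise-cong {x} {y} x≈y x≢0 y≢0 = ℚ.Cross⇒≈ λ _ → ℚ.cross-by
      (specialise-num x x≢0) (specialise-den y y≢0) (specialise-num y y≢0) (specialise-den x x≢0)
      (ℚX.≈⇒Cross x≈y N)

    specialise-injective : ∀ {x y} → specialise N x ℚ.≈ specialise N y →
                           denAt N x ≢ 0ℤ → denAt N y ≢ 0ℤ → ℚX.Cross N x y
    specialise-injective {x} {y} eq x≢0 y≢0 = ℚ.cross-by
      (sym (specialise-num x x≢0)) (sym (specialise-den y y≢0))
      (sym (specialise-num y y≢0)) (sym (specialise-den x x≢0)) (ℚ.≈⇒Cross eq 0)

  module Approximant (B : ℕ) where

    open FieldOnℕ ℚ⟨X⟩ using () renaming (_+_ to _+ˣ_; _*_ to _*ˣ_)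

    -- Every term with code below B has its value in ℚ(X) below M.
    M : ℕ
    M = suc (max 0 (map (evalTerm ℚ⟨X⟩) (terms B B)))

    value<M : ∀ t → Bounded t B B → evalTerm ℚ⟨X⟩ t < M
    value<M t bounded = s≤s (All.lookup (xs≤max 0 (map (evalTerm ℚ⟨X⟩) (terms B B)))
                                        (∈-map⁺ (evalTerm ℚ⟨X⟩) (∈-terms⁺ t bounded)))

    Separating : ℕ → Set
    Separating N = ∀ k → k < M → ℚX.denAt N (elementX k) ≢ 0ℤ
                                × (∀ j → j < M → k ≢ j → ¬ ℚX.Cross N (elementX k) (elementX j))

    eventually-separating : Eventually Separating
    eventually-separating = eventually-∀< M λ k _ → eventually-×
      (ℚX.eventually-denAt≢0 (elementX k))
      (eventually-∀< M λ j _ → separate k j)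
      where
      separate : ∀ k j → Eventually (λ N → k ≢ j → ¬ ℚX.Cross N (elementX k) (elementX j))
      separate k j with k ≟ j
      ... | yes k≡j = 0 , λ _ _ k≢j → ⊥-elim (k≢j k≡j)
      ... | no  k≢j with ℚX.≉⇒eventually-¬Cross (λ k≈j → k≢j (RationalFunctions.element-injective k≈j))
      ...   | T , apart = T , λ N T≤N _ → apart N T≤N

    N : ℕ
    N = proj₁ eventually-separating

    separating : Separating N
    separating = proj₂ eventually-separating N ℕ.≤-refl

    den≢0 : ∀ k → k < M → ℚX.denAt N (elementX k) ≢ 0ℤ
    den≢0 k k<M = proj₁ (separating k k<M)

    v : ℕ → ℚ.Fraction
    v k = specialise N (elementX k)

    enum : ℕ → ℚ.Fraction
    enum = prefixed M v ℚ.enum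

    index : ℚ.Fraction → ℕ
    index q = M ℕ.+ ℚ.index q

    enum-index : ∀ q → enum (index q) ℚ.≈ q
    enum-index q = subst (ℚ._≈ q) (sym (prefixed-+ M v ℚ.enum (ℚ.index q))) (ℚ.enum-index q)

    open ℚ.Elements enum index enum-index using (fieldOnℕ; element; element-prefix; element-injective; +-homo; *-homo)

    approximant : FieldOnℕ
    approximant = fieldOnℕ

    open FieldOnℕ approximant using () renaming (_+_ to _+ᴬ_; _*_ to _*ᴬ_)

    enum-distinct : ∀ i j → i < j → j < M → ¬ (enum i ℚ.≈ enum j)
    enum-distinct i j i<j j<M eq = proj₂ (separating i i<M) j j<M (ℕ.<⇒≢ i<j)
      (specialise-injective N (subst₂ ℚ._≈_ (prefixed-< M v ℚ.enum i<M) (prefixed-< M v ℚ.enum j<M) eq)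
                              (den≢0 i i<M) (den≢0 j j<M))
      where i<M = ℕ.<-trans i<j j<M

    element≡v : ∀ k → k < M → element k ≡ v k
    element≡v k k<M = trans (element-prefix M enum-distinct k k<M) (prefixed-< M v ℚ.enum k<M)

    open ℚ using (_∙_)

    -- Specialisation at N is a homomorphism on fractions whose denominators do not vanish at N.
    +-agrees : ∀ a b → a < M → b < M → a +ˣ b < M → a +ᴬ b ≡ a +ˣ b
    +-agrees a b a<M b<M ab<M = element-injective
      ( +-homo a b ∙ ℚ.⊕-cong (ℚ.≈-reflexive (element≡v a a<M)) (ℚ.≈-reflexive (element≡v b b<M))
      ∙ ℚ.≈-sym (specialise-⊕ N (elementX a) (elementX b) (den≢0 a a<M) (den≢0 b b<M))
      ∙ specialise-cong N (ℚX.≈-sym (RationalFunctions.+-homo a b))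
          (denAt-⊕-≢0 N (elementX a) (elementX b) (den≢0 a a<M) (den≢0 b b<M)) (den≢0 _ ab<M)
      ∙ ℚ.≈-reflexive (sym (element≡v _ ab<M)))

    *-agrees : ∀ a b → a < M → b < M → a *ˣ b < M → a *ᴬ b ≡ a *ˣ b
    *-agrees a b a<M b<M ab<M = element-injective
      ( *-homo a b ∙ ℚ.⊗-cong (ℚ.≈-reflexive (element≡v a a<M)) (ℚ.≈-reflexive (element≡v b b<M))
      ∙ ℚ.≈-sym (specialise-⊗ N (elementX a) (elementX b) (den≢0 a a<M) (den≢0 b b<M))
      ∙ specialise-cong N (ℚX.≈-sym (RationalFunctions.*-homo a b))
          (denAt-⊗-≢0 N (elementX a) (elementX b) (den≢0 a a<M) (den≢0 b b<M)) (den≢0 _ ab<M)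
      ∙ ℚ.≈-reflexive (sym (element≡v _ ab<M)))

    evalTerm-agrees : ∀ t → Bounded t B B → evalTerm approximant t ≡ evalTerm ℚ⟨X⟩ t
    evalTerm-agrees (con n) _ = refl
    evalTerm-agrees (plus s t) bounded =
      trans (cong₂ _+ᴬ_ (evalTerm-agrees s bs) (evalTerm-agrees t bt))
            (+-agrees (evalTerm ℚ⟨X⟩ s) (evalTerm ℚ⟨X⟩ t)
                      (value<M s bs) (value<M t bt) (value<M (plus s t) bounded))
      where
      bs = proj₁ (Bounded-plus⁻ s t bounded)
      bt = proj₂ (Bounded-plus⁻ s t bounded)
    evalTerm-agrees (times s t) bounded =
      trans (cong₂ _*ᴬ_ (evalTerm-agrees s bs) (evalTerm-agrees t bt))
            (*-agrees (evalTerm ℚ⟨X⟩ s) (evalTerm ℚ⟨X⟩ t)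
                      (value<M s bs) (value<M t bt) (value<M (times s t) bounded))
      where
      bs = proj₁ (Bounded-times⁻ s t bounded)
      bt = proj₂ (Bounded-times⁻ s t bounded)

    diagram-agrees : AgreeBelow B (diagram ℚ⟨X⟩) (diagram approximant)
    diagram-agrees x x<B = diagram-local ℚ⟨X⟩ approximant x λ t t∈ →
      sym (evalTerm-agrees t (Bounded-mono t (ℕ.<⇒≤ x<B) (ℕ.<⇒≤ x<B) (∈-terms⁻ t x x t∈)))

    approximant-algebraic : ∀ y → ¬ FieldOnℕ.Transc approximant y
    approximant-algebraic = Algebraic.no-transcendental enum index enum-index

  approximation : ∀ B → ∃[ K ] (AgreeBelow B (diagram ℚ⟨X⟩) (diagram K) × ∀ y → ¬ FieldOnℕ.Transc K y)
  approximation B = approximant , diagram-agrees , approximant-algebraic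
    where open Approximant B

module NoUniformExpansion where

  open import Data.Nat using (ℕ)
  open import Data.Bool using (true)
  open import Data.List using ([]; _∷_)
  open import Data.Vec using ([]; _∷_)
  open import Data.Product using (_×_; _,_; proj₁; ∃-syntax)
  open import Relation.Nullary using (¬_)
  open import Relation.Binary.PropositionalEquality using (_≡_; refl; sym; subst)
  open import Function using (_∘_)
  open import Function.Bundles using (_⇔_; Equivalence)
  open import Defs
  open Computation using (Eval-functional; Eval-use)
  open Diagram using (diagram; diagram-isDiagram)
  open Transcendence using (Transc-≅; module Inverse)
  open RationalFunctions using (ℚ⟨X⟩; x; x-transcendental)
  open Approximation using (approximation)

  copy-of-ℚ⟨X⟩-has-transcendental : ∀ L → L ≅ ℚ⟨X⟩ → ∃[ n ] FieldOnℕ.Transc L n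
  copy-of-ℚ⟨X⟩-has-transcendental L iso = h⁻¹ x , Equivalence.from (Transc-≅ L ℚ⟨X⟩ iso (h⁻¹ x))
    (subst (FieldOnℕ.Transc ℚ⟨X⟩) (sym (h-h⁻¹ x)) x-transcendental)
    where open Inverse L ℚ⟨X⟩ iso

  copy-has-no-transcendental : ∀ L K → L ≅ K → (∀ y → ¬ FieldOnℕ.Transc K y) →
                               ∀ n → ¬ FieldOnℕ.Transc L n
  copy-has-no-transcendental L K iso algebraic n = algebraic _ ∘ Equivalence.to (Transc-≅ L K iso n)

  bit≡1 : ∀ {b} → bit b ≡ 1 → b ≡ true
  bit≡1 {true} _ = refl

  module _ {Atom′ : Set} (code : Atom′ → ℕ) (sat : FieldOnℕ → Atom′ → Set) (T : ℕ → Atom′)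
           (sat-T : ∀ L n → sat L (T n) ⇔ FieldOnℕ.Transc L n) where

    module _ {Ψ F D L} (computes : Computes Ψ F D) (D-diagram : IsDiagramOf code (sat L) D)
             {φ : Atom′} where

      accepts : sat L φ → Eval F Ψ (code φ ∷ []) 1
      accepts satφ = subst (λ b → Eval F Ψ (code φ ∷ []) (bit b))
        (Equivalence.from (proj₁ D-diagram φ) satφ) (computes (code φ))

      accepted⇒ : Eval F Ψ (code φ ∷ []) 1 → sat L φ
      accepted⇒ eval =
        Equivalence.to (proj₁ D-diagram φ) (bit≡1 (Eval-functional (computes (code φ)) eval))

    UniformExpansion : Prog 1 → Set
    UniformExpansion Ψ = ∀ K F → IsDiagramOf codeAtom (Sat K) F →
                         ∃[ D ] (Computes Ψ F D × ∃[ L ] (L ≅ K × IsDiagramOf code (sat L) D))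

    no-uniform-expansion : ¬ (∃[ Ψ ] UniformExpansion Ψ)
    no-uniform-expansion (Ψ , expand) =
      let D , computes , L , L≅ℚ⟨X⟩ , D-diagram = run ℚ⟨X⟩
          n , transc = copy-of-ℚ⟨X⟩-has-transcendental L L≅ℚ⟨X⟩
          B , use = Eval-use (accepts computes D-diagram (Equivalence.from (sat-T L n) transc))
          K , agree , algebraic = approximation B
          D′ , computes′ , L′ , L′≅K , D′-diagram = run K
      in copy-has-no-transcendental L′ K L′≅K algebraic n
           (Equivalence.to (sat-T L′ n) (accepted⇒ computes′ D′-diagram (use (diagram K) agree)))
      where
      run : ∀ K → ∃[ D ] (Computes Ψ (diagram K) D × ∃[ L ] (L ≅ K × IsDiagramOf code (sat L) D))
      run K = expand K (diagram K) (diagram-isDiagram K)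

corollary1 :
    (¬ (∃[ Ψ ] (∀ (K : FieldOnℕ) (F : ℕ → Bool) → IsDiagramOf codeAtom (Sat K) F →
        ∃[ D ] (Computes Ψ F D × IsTDiagramFor K D))))
    ×
    (¬ (∃[ Ψ ] (∀ (K : FieldOnℕ) (F : ℕ → Bool) → IsDiagramOf codeAtom (Sat K) F →
        ∃[ D ] (Computes Ψ F D × IsIDiagramFor K D))))
corollary1 =
    NoUniformExpansion.no-uniform-expansion codeAtomT SatT (λ n → TT (con n)) (λ _ _ → mk⇔ id id)
  , NoUniformExpansion.no-uniform-expansion codeAtomI SatI (λ n → II (con n ∷ [])) (λ _ _ → mk⇔ id id)
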